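{- Let $r\ge2$, $2\le k\le r+1$, $n\ge1$, $s\ge1$ be integers, and let $t=k-1$. Then \begin{multline*} {\rm ex}(t^s n,H_k^r) \geq t^{sr}{\rm ex}(n,H_k^r) + \frac{1}{n}\sum_{i=1}^{s-1}(t-1)t^{sr-ir-i}\binom{t^i n}{r} + \frac{1}{n}t^{ -s+1}\binom{t^s n}{r} \\ - \frac{1}{n}t^{sr}\binom{n}{r} - \frac{r-1}{n}\sum_{i=1}^{s}\frac{t-1}{2}\,t^{sr-ir+r-i}\binom{t^{i-1}n}{r-1}. \end{multline*}
   Context: $H_k^r$ is the $r$-uniform hypergraph with $r+1$ vertices and $k$ edges ($k\le r+1$); ${\rm ex}(n,H)$ is the maximum number of edges in an $r$-uniform hypergraph on $n$ vertices with no subgraph isomorphic to $H$. -}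

module Defs where

open import Data.Nat as ℕ using (ℕ; zero; suc; _<?_)
open import Data.Integer using (+_)
open import Data.Rational using (ℚ; _/_; 0ℚ; _+_; _*_)
open import Data.Fin using (Fin; toℕ)
open import Data.Fin.Subset using (Subset; _∈_; ⁅_⁆; ∁; ∣_∣)
open import Data.List using (List; length; map; filter; allFin)
open import Data.List.Relation.Unary.All using (All)
open import Data.List.Relation.Unary.Any using (Any)
open import Data.List.Relation.Unary.Unique.Propositional using (Unique)
import Data.List.Membership.Propositional as LM
open import Data.Product using (Σ; ∃; _×_)
open import Function.Bundles using (_⇔_)
open import Function.Definitions using (Injective)
open import Relation.Binary.PropositionalEquality using (_≡_)
open import Relation.Nullary using (¬_)

record Hypergraph (r n : ℕ) : Set where
  field
    edges   : List (Subset n)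
    unique  : Unique edges
    uniform : All (λ e → ∣ e ∣ ≡ r) edges
open Hypergraph public

∥_∥ : ∀ {r n} → Hypergraph r n → ℕ
∥ G ∥ = length (edges G)

IsImage : ∀ {m n} → (Fin m → Fin n) → Subset m → Subset n → Set
IsImage {m} f e e' = ∀ y → (y ∈ e') ⇔ (Σ (Fin m) λ x → x ∈ e × f x ≡ y)

ContainsCopy : ∀ {r m n} → List (Subset m) → Hypergraph r n → Set
ContainsCopy {m = m} {n = n} Hs G =
  Σ (Fin m → Fin n) λ f → Injective _≡_ _≡_ f ×
    All (λ e → Any (λ e' → IsImage f e e') (edges G)) Hs

-- H_k^r : vertex set Fin (r+1); edges are the r-sets Fin(r+1) ∖ {j} for j < k
-- (for k ≤ r+1 this gives exactly k edges).
H-edges : (r k : ℕ) → List (Subset (suc r))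
H-edges r k = map (λ j → ∁ ⁅ j ⁆) (filter (λ j → toℕ j <? k) (allFin (suc r)))

HFree : (k : ℕ) → ∀ {r n} → Hypergraph r n → Set
HFree k {r} G = ¬ ContainsCopy (H-edges r k) G

IsEx : (r k n e : ℕ) → Set
IsEx r k n e =
  (Σ (Hypergraph r n) λ G → HFree k G × ∥ G ∥ ≡ e) ×
  ((G : Hypergraph r n) → HFree k G → ∥ G ∥ ℕ.≤ e)

ℚ[_] : ℕ → ℚ
ℚ[ m ] = (+ m) / 1

-- division of a rational by a natural number (only used with nonzero divisors)
_/ℕ_ : ℚ → ℕ → ℚ
x /ℕ zero = 0ℚ
x /ℕ suc m = x * ((+ 1) / suc m)

Σ₁ : ℕ → (ℕ → ℚ) → ℚ
Σ₁ zero f = 0ℚ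
Σ₁ (suc m) f = Σ₁ m f + f (suc m)

-- Blow up every vertex of an H_k^r-free r-graph G on m vertices into a fibre of t = k - 1
-- vertices. An r-set of the blow-up is kept if it meets r distinct fibres above an edge of G,
-- or if it has at least two collisions (the sizes of its traces on the fibres, minus one,
-- summed) and the sum of its fibre indices is c modulo m; r-sets with exactly one collision
-- are never kept. A copy of H_k^r in the result either projects injectively to the fibres,
-- and then onto a copy in G, or it has two vertices in one fibre. Then an edge of the copy
-- through both has a collision, hence at least two, so the vertex set of the copy has at
-- least two collisions and each of its k edges, missing one vertex, has at least one. All
-- k edges thus have residue c, which puts the k missing vertices into one fibre of size
-- k - 1. Averaging over c gives
--   m ex(mt) ≥ m t^r ex(m) + C(mt, r) - t^r C(m, r) - D(m, r),
-- with D(m, r) the number of r-sets with one collision, and the bound follows by iterating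
-- from n to t^s n vertices; the sums in the statement are this recurrence unrolled.
module Submission where

open import Defs
open import Data.Nat using (ℕ)

module Combinatorics where

  open import Data.Bool using (Bool; true; false)
  open import Data.Bool.Properties using (⇔→≡) renaming (_≟_ to _≟ᵇ_)
  open import Data.Nat as ℕ
    using (zero; suc; _+_; _*_; _∸_; _^_; _≤_; _<_; z≤n; s≤s; s≤s⁻¹; _≟_; _≤?_; _<?_; _<ᵇ_; _%_; _/_; NonZero)
  open import Data.Nat.Properties
  open import Data.Nat.DivMod using (m≡m%n+[m/n]*n; [m+kn]%n≡m%n; m<n⇒m%n≡m; m%n<n)
  open import Data.Nat.Combinatorics using (_C_; nC1≡n; nCk+nC[k+1]≡[n+1]C[k+1])
  open import Data.Nat.Solver using (module +-*-Solver)
  open +-*-Solver using (solve; _:+_; _:*_; _:=_; con)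
  open import Data.Fin as Fin using (Fin; zero; suc; toℕ; combine; quotient; remainder; inject≤)
  open import Data.Fin.Properties as Finₚ
    using (remQuot-combine; combine-remQuot; toℕ<n; toℕ-injective; pigeonhole; inject≤-injective; toℕ-inject≤; any?)
  open import Data.Fin.Subset using (Subset; inside; outside; ∣_∣; ⁅_⁆; ∁) renaming (_∈_ to _∈ₛ_)
  open import Data.Fin.Subset.Properties using (x∈⁅x⁆; x≢y⇒x∉⁅y⁆; x∉p⇒x∈∁p; x∈p⇒x∉∁p)
  open import Data.List as List using (List; []; _∷_; map; length; filter; cartesianProductWith; downFrom)
  open import Data.List.Properties using (length-map; length-downFrom)
  open import Data.List.Relation.Unary.Any using (Any; here; there)
  open import Data.List.Relation.Unary.All as All using (All; []; _∷_)
  open import Data.List.Relation.Unary.Unique.Propositional using (Unique; []; _∷_)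
  import Data.List.Relation.Unary.Unique.Propositional.Properties as Unique
  open import Data.List.Membership.Propositional using (_∈_; _∉_; find; lose)
  open import Data.List.Membership.Propositional.Properties
    using (∈-cartesianProductWith⁺; ∈-downFrom⁺; ∈-map⁺; ∈-map⁻; ∈-filter⁺; ∈-filter⁻; ∈-allFin)
  open import Data.Vec using (Vec; []; _∷_; _++_; lookup; tabulate; concat)
  open import Data.Vec.Properties
    using (∷-injective; ≡-dec; lookup-concat; lookup∘tabulate; tabulate∘lookup; tabulate-cong;
           []=⇒lookup; lookup⇒[]=; ++-injective)
  open import Data.Product using (Σ; ∃; ∃₂; _×_; _,_; proj₁; proj₂)
  open import Data.Sum using (_⊎_; inj₁; inj₂)
  open import Data.Empty using (⊥; ⊥-elim)
  open import Function using (_∘_; mk⇔; Equivalence)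
  open import Function.Definitions using (Injective)
  open import Relation.Binary.Definitions using (DecidableEquality)
  open import Relation.Binary.PropositionalEquality
    using (_≡_; _≢_; refl; sym; trans; cong; cong₂; subst; subst₂; module ≡-Reasoning)
  open import Relation.Nullary using (Dec; yes; no; does; _because_; ¬_; _×-dec_; _⊎-dec_)
  open import Relation.Nullary.Decidable using (dec-true)

  private variable
    A B D : Set
    m n : ℕ

  -- Matching on the boolean only, so 𝟙 P? computes as soon as does P? does.
  𝟙 : {P : Set} → Dec P → ℕ
  𝟙 (true  because _) = 1
  𝟙 (false because _) = 0

  𝟙-cong : ∀ {P Q : Set} → (P → Q) → (Q → P) → (P? : Dec P) (Q? : Dec Q) → 𝟙 P? ≡ 𝟙 Q?
  𝟙-cong P→Q Q→P (yes _) (yes _) = refl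
  𝟙-cong P→Q Q→P (yes p) (no ¬q) = ⊥-elim (¬q (P→Q p))
  𝟙-cong P→Q Q→P (no ¬p) (yes q) = ⊥-elim (¬p (Q→P q))
  𝟙-cong P→Q Q→P (no _)  (no _)  = refl

  𝟙-×-⊎ : ∀ {P Q R S U : Set} (P? : Dec P) (Q? : Dec Q) (R? : Dec R) (S? : Dec S) (U? : Dec U) → ¬ (Q × S) →
           𝟙 (P? ×-dec (Q? ×-dec R? ⊎-dec S? ×-dec U?)) ≡ 𝟙 P? * 𝟙 Q? * 𝟙 R? + 𝟙 P? * 𝟙 S? * 𝟙 U?
  𝟙-×-⊎ (no _)  _       _       _       _       _        = refl
  𝟙-×-⊎ (yes _) (yes q) _       (yes s) _       disjoint = ⊥-elim (disjoint (q , s))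
  𝟙-×-⊎ (yes _) (yes _) (yes _) (no _)  _       _        = refl
  𝟙-×-⊎ (yes _) (yes _) (no _)  (no _)  _       _        = refl
  𝟙-×-⊎ (yes _) (no _)  _       (yes _) (yes _) _        = refl
  𝟙-×-⊎ (yes _) (no _)  _       (yes _) (no _)  _        = refl
  𝟙-×-⊎ (yes _) (no _)  _       (no _)  _       _        = refl

  ∑ : List A → (A → ℕ) → ℕ
  ∑ []       w = 0
  ∑ (x ∷ xs) w = w x + ∑ xs w

  syntax ∑ xs (λ x → e) = ∑[ x ∈ xs ] e

  ∑-++ : ∀ (xs ys : List A) w → ∑ (xs List.++ ys) w ≡ ∑ xs w + ∑ ys w
  ∑-++ []       ys w = refl
  ∑-++ (x ∷ xs) ys w = trans (cong (w x +_) (∑-++ xs ys w)) (sym (+-assoc (w x) _ _))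

  ∑-map : ∀ (f : A → B) xs w → ∑ (map f xs) w ≡ ∑ xs (w ∘ f)
  ∑-map f []       w = refl
  ∑-map f (x ∷ xs) w = cong (w (f x) +_) (∑-map f xs w)

  ∑-cong : ∀ (xs : List A) {v w} → (∀ x → v x ≡ w x) → ∑ xs v ≡ ∑ xs w
  ∑-cong []       v≗w = refl
  ∑-cong (x ∷ xs) v≗w = cong₂ _+_ (v≗w x) (∑-cong xs v≗w)

  ∑-zero : ∀ (xs : List A) → ∑[ x ∈ xs ] 0 ≡ 0
  ∑-zero []       = refl
  ∑-zero (x ∷ xs) = ∑-zero xs

  ∑-distrib-+ : ∀ (xs : List A) v w → ∑[ x ∈ xs ] (v x + w x) ≡ ∑ xs v + ∑ xs w
  ∑-distrib-+ []       v w = refl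
  ∑-distrib-+ (x ∷ xs) v w =
    trans (cong (v x + w x +_) (∑-distrib-+ xs v w))
          (interchange (v x) (w x) (∑ xs v) (∑ xs w))
    where
    interchange : ∀ a b c d → (a + b) + (c + d) ≡ (a + c) + (b + d)
    interchange = solve 4 (λ a b c d → (a :+ b) :+ (c :+ d) := (a :+ c) :+ (b :+ d)) refl

  ∑-distribˡ-* : ∀ (xs : List A) c w → ∑[ x ∈ xs ] (c * w x) ≡ c * ∑ xs w
  ∑-distribˡ-* []       c w = sym (*-zeroʳ c)
  ∑-distribˡ-* (x ∷ xs) c w =
    trans (cong (c * w x +_) (∑-distribˡ-* xs c w)) (sym (*-distribˡ-+ c (w x) (∑ xs w)))

  ∑-comm : ∀ (xs : List A) (ys : List B) (w : A → B → ℕ) →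
           ∑[ x ∈ xs ] ∑[ y ∈ ys ] w x y ≡ ∑[ y ∈ ys ] ∑[ x ∈ xs ] w x y
  ∑-comm []       ys w = sym (∑-zero ys)
  ∑-comm (x ∷ xs) ys w =
    trans (cong (∑ ys (w x) +_) (∑-comm xs ys w)) (sym (∑-distrib-+ ys (w x) _))

  ∑-cartesianProductWith : ∀ (f : A → B → D) xs ys (w : D → ℕ) →
    ∑ (cartesianProductWith f xs ys) w ≡ ∑[ x ∈ xs ] ∑[ y ∈ ys ] w (f x y)
  ∑-cartesianProductWith f []       ys w = refl
  ∑-cartesianProductWith f (x ∷ xs) ys w = begin
    ∑ (map (f x) ys List.++ cartesianProductWith f xs ys) w
      ≡⟨ ∑-++ (map (f x) ys) _ w ⟩
    ∑ (map (f x) ys) w + ∑ (cartesianProductWith f xs ys) w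
      ≡⟨ cong₂ _+_ (∑-map (f x) ys w) (∑-cartesianProductWith f xs ys w) ⟩
    ∑[ y ∈ ys ] w (f x y) + ∑[ x′ ∈ xs ] ∑[ y ∈ ys ] w (f x′ y)
      ∎
    where open ≡-Reasoning

  length-filter≡∑𝟙 : ∀ {P : A → Set} (P? : ∀ x → Dec (P x)) xs →
                     length (filter P? xs) ≡ ∑[ x ∈ xs ] 𝟙 (P? x)
  length-filter≡∑𝟙 P? []       = refl
  length-filter≡∑𝟙 P? (x ∷ xs) with P? x
  ... | yes _ = cong suc (length-filter≡∑𝟙 P? xs)
  ... | no _  = length-filter≡∑𝟙 P? xs

  vectorsOver : List A → ∀ m → List (Vec A m)
  vectorsOver xs zero    = [] ∷ []
  vectorsOver xs (suc m) = cartesianProductWith _∷_ xs (vectorsOver xs m)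

  ∑-vectorsOver-suc : ∀ (xs : List A) m w →
    ∑ (vectorsOver xs (suc m)) w ≡ ∑[ x ∈ xs ] ∑[ v ∈ vectorsOver xs m ] w (x ∷ v)
  ∑-vectorsOver-suc xs m w = ∑-cartesianProductWith _∷_ xs (vectorsOver xs m) w

  vectorsOver-unique : {xs : List A} → Unique xs → ∀ m → Unique (vectorsOver xs m)
  vectorsOver-unique u zero    = [] ∷ []
  vectorsOver-unique u (suc m) =
    Unique.cartesianProductWith⁺ _∷_ ∷-injective u (vectorsOver-unique u m)

  ∈-vectorsOver : {xs : List A} → (∀ x → x ∈ xs) → (v : Vec A m) → v ∈ vectorsOver xs m
  ∈-vectorsOver all∈ []      = here refl
  ∈-vectorsOver all∈ (x ∷ v) = ∈-cartesianProductWith⁺ _∷_ (all∈ x) (∈-vectorsOver all∈ v)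

  module _ (_≟_ : DecidableEquality A) where
    open import Data.List.Membership.DecPropositional _≟_ using (_∈?_)

    ∑-≟-∉ : ∀ {x} xs → x ∉ xs → ∑[ y ∈ xs ] 𝟙 (y ≟ x) ≡ 0
    ∑-≟-∉ []       x∉xs = refl
    ∑-≟-∉ {x} (y ∷ xs) x∉xs with y ≟ x
    ... | yes refl = ⊥-elim (x∉xs (here refl))
    ... | no _     = ∑-≟-∉ xs (x∉xs ∘ there)

    ∑-≟-unique : ∀ {x xs} → Unique xs → x ∈ xs → ∑[ y ∈ xs ] 𝟙 (y ≟ x) ≡ 1
    ∑-≟-unique {x} {y ∷ xs} (y∉xs ∷ u) x∈ with y ≟ x | x∈
    ... | yes refl | _         = cong suc (∑-≟-∉ xs (λ y∈xs → All.lookup y∉xs y∈xs refl))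
    ... | no y≢x   | here x≡y  = ⊥-elim (y≢x (sym x≡y))
    ... | no _     | there x∈′ = ∑-≟-unique u x∈′

    ∑-∈? : ∀ {xs} → Unique xs → (∀ x → x ∈ xs) → ∀ {L} → Unique L →
           ∑[ y ∈ xs ] 𝟙 (y ∈? L) ≡ length L
    ∑-∈? {xs} uxs all∈ {[]}    _          = ∑-zero xs
    ∑-∈? {xs} uxs all∈ {x ∷ L} (x∉L ∷ uL) = begin
      ∑[ y ∈ xs ] 𝟙 (y ∈? x ∷ L)              ≡⟨ ∑-cong xs split ⟩
      ∑[ y ∈ xs ] (𝟙 (y ≟ x) + 𝟙 (y ∈? L))   ≡⟨ ∑-distrib-+ xs _ _ ⟩
      ∑[ y ∈ xs ] 𝟙 (y ≟ x) + ∑[ y ∈ xs ] 𝟙 (y ∈? L)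
        ≡⟨ cong₂ _+_ (∑-≟-unique uxs (all∈ x)) (∑-∈? uxs all∈ uL) ⟩
      suc (length L)                         ∎
      where
      open ≡-Reasoning
      split : ∀ y → 𝟙 (y ∈? x ∷ L) ≡ 𝟙 (y ≟ x) + 𝟙 (y ∈? L)
      split y with y ≟ x | y ∈? L
      ... | yes refl | yes y∈L = ⊥-elim (All.lookup x∉L y∈L refl)
      ... | yes _    | no _    = refl
      ... | no _     | yes _   = refl
      ... | no _     | no _    = refl

  average≤max : ∀ (x : A) xs (F : A → ℕ) → ∃ λ y → ∑ (x ∷ xs) F ≤ length (x ∷ xs) * F y
  average≤max x []        F = x , ≤-refl
  average≤max x (x′ ∷ xs) F with y , ∑≤ ← average≤max x′ xs F with F x ≤? F y
  ... | yes Fx≤Fy = y , +-mono-≤ Fx≤Fy ∑≤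
  ... | no  Fx≰Fy = x , +-monoʳ-≤ (F x) (≤-trans ∑≤ (*-monoʳ-≤ (length (x′ ∷ xs)) (<⇒≤ (≰⇒> Fx≰Fy))))

  𝟙-suc : ∀ a k → 𝟙 (suc a ≟ suc k) ≡ 𝟙 (a ≟ k)
  𝟙-suc a k = 𝟙-cong suc-injective (cong suc) (suc a ≟ suc k) (a ≟ k)

  subsets : ∀ n → List (Subset n)
  subsets = vectorsOver (outside ∷ inside ∷ [])

  subsets-unique : ∀ n → Unique (subsets n)
  subsets-unique = vectorsOver-unique (((λ ()) ∷ []) ∷ [] ∷ [])

  ∈-subsets : ∀ {n} (p : Subset n) → p ∈ subsets n
  ∈-subsets = ∈-vectorsOver λ { false → here refl ; true → there (here refl) }

  ∑-subsets-suc : ∀ n (w : Subset (suc n) → ℕ) →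
    ∑ (subsets (suc n)) w ≡ ∑[ p ∈ subsets n ] w (outside ∷ p) + ∑[ p ∈ subsets n ] w (inside ∷ p)
  ∑-subsets-suc n w = trans (∑-vectorsOver-suc (outside ∷ inside ∷ []) n w)
                            (cong (∑[ p ∈ subsets n ] w (outside ∷ p) +_) (+-identityʳ _))

  ∑-subsets-++ : ∀ a c (w : Subset (a + c) → ℕ) →
    ∑ (subsets (a + c)) w ≡ ∑[ p ∈ subsets a ] ∑[ q ∈ subsets c ] w (p ++ q)
  ∑-subsets-++ zero    c w = sym (+-identityʳ _)
  ∑-subsets-++ (suc a) c w = begin
    ∑ (subsets (suc a + c)) w
      ≡⟨ ∑-subsets-suc (a + c) w ⟩
    ∑[ q ∈ subsets (a + c) ] w (outside ∷ q) + ∑[ q ∈ subsets (a + c) ] w (inside ∷ q)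
      ≡⟨ cong₂ _+_ (∑-subsets-++ a c _) (∑-subsets-++ a c _) ⟩
    ∑[ p ∈ subsets a ] ∑[ q ∈ subsets c ] w (outside ∷ p ++ q)
      + ∑[ p ∈ subsets a ] ∑[ q ∈ subsets c ] w (inside ∷ p ++ q)
      ≡⟨ ∑-subsets-suc a _ ⟨
    ∑[ p ∈ subsets (suc a) ] ∑[ q ∈ subsets c ] w (p ++ q)
      ∎
    where open ≡-Reasoning

  ∑-subsets-size : ∀ n k → ∑[ p ∈ subsets n ] 𝟙 (∣ p ∣ ≟ k) ≡ n C k
  ∑-subsets-size zero    zero    = refl
  ∑-subsets-size zero    (suc k) = refl
  ∑-subsets-size (suc n) k       = trans (∑-subsets-suc n _) (split k)
    where
    split : ∀ k → ∑[ p ∈ subsets n ] 𝟙 (∣ p ∣ ≟ k) + ∑[ p ∈ subsets n ] 𝟙 (suc ∣ p ∣ ≟ k) ≡ suc n C k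
    split zero    = cong₂ _+_ (∑-subsets-size n 0) (∑-zero (subsets n))
    split (suc k) = begin
      ∑[ p ∈ subsets n ] 𝟙 (∣ p ∣ ≟ suc k) + ∑[ p ∈ subsets n ] 𝟙 (suc ∣ p ∣ ≟ suc k)
        ≡⟨ cong (∑[ p ∈ subsets n ] 𝟙 (∣ p ∣ ≟ suc k) +_) (∑-cong (subsets n) (λ p → 𝟙-suc ∣ p ∣ k)) ⟩
      ∑[ p ∈ subsets n ] 𝟙 (∣ p ∣ ≟ suc k) + ∑[ p ∈ subsets n ] 𝟙 (∣ p ∣ ≟ k)
        ≡⟨ cong₂ _+_ (∑-subsets-size n (suc k)) (∑-subsets-size n k) ⟩
      n C suc k + n C k   ≡⟨ +-comm (n C suc k) (n C k) ⟩
      n C k + n C suc k   ≡⟨ nCk+nC[k+1]≡[n+1]C[k+1] n k ⟩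
      suc n C suc k       ∎
      where open ≡-Reasoning

  ∑-subsets-∣∣≤2 : ∀ n (ψ : ℕ → ℕ) → (∀ a → ψ (3 + a) ≡ 0) →
    ∑[ p ∈ subsets n ] ψ ∣ p ∣ ≡ ψ 0 + n * ψ 1 + (n C 2) * ψ 2
  ∑-subsets-∣∣≤2 zero    ψ ψ≥3≡0 = sym (+-identityʳ (ψ 0 + 0))
  ∑-subsets-∣∣≤2 (suc n) ψ ψ≥3≡0 = begin
    ∑[ p ∈ subsets (suc n) ] ψ ∣ p ∣
      ≡⟨ ∑-subsets-suc n _ ⟩
    ∑[ p ∈ subsets n ] ψ ∣ p ∣ + ∑[ p ∈ subsets n ] ψ (suc ∣ p ∣)
      ≡⟨ cong₂ _+_ (∑-subsets-∣∣≤2 n ψ ψ≥3≡0) (∑-subsets-∣∣≤2 n (ψ ∘ suc) (ψ≥3≡0 ∘ suc)) ⟩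
    (ψ 0 + n * ψ 1 + (n C 2) * ψ 2) + (ψ 1 + n * ψ 2 + (n C 2) * ψ 3)
      ≡⟨ cong (λ z → (ψ 0 + n * ψ 1 + (n C 2) * ψ 2) + (ψ 1 + n * ψ 2 + (n C 2) * z)) (ψ≥3≡0 0) ⟩
    (ψ 0 + n * ψ 1 + (n C 2) * ψ 2) + (ψ 1 + n * ψ 2 + (n C 2) * 0)
      ≡⟨ solve 5 (λ a b c n d → (a :+ n :* b :+ d :* c) :+ (b :+ n :* c :+ d :* con 0)
                               := a :+ (con 1 :+ n) :* b :+ (n :+ d) :* c)
               refl (ψ 0) (ψ 1) (ψ 2) n (n C 2) ⟩
    ψ 0 + suc n * ψ 1 + (n + n C 2) * ψ 2
      ≡⟨ cong (λ z → ψ 0 + suc n * ψ 1 + z * ψ 2) pascal ⟩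
    ψ 0 + suc n * ψ 1 + (suc n C 2) * ψ 2
      ∎
    where
    open ≡-Reasoning
    pascal : n + n C 2 ≡ suc n C 2
    pascal = trans (cong (_+ n C 2) (sym (nC1≡n n))) (nCk+nC[k+1]≡[n+1]C[k+1] n 1)

  2*[1+n]C2 : ∀ n → 2 * (suc n C 2) ≡ suc n * n
  2*[1+n]C2 zero    = refl
  2*[1+n]C2 (suc n) = begin
    2 * (suc (suc n) C 2)             ≡⟨ cong (2 *_) (nCk+nC[k+1]≡[n+1]C[k+1] (suc n) 1) ⟨
    2 * (suc n C 1 + suc n C 2)       ≡⟨ cong (λ z → 2 * (z + suc n C 2)) (nC1≡n (suc n)) ⟩
    2 * (suc n + suc n C 2)           ≡⟨ *-distribˡ-+ 2 (suc n) (suc n C 2) ⟩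
    2 * suc n + 2 * (suc n C 2)       ≡⟨ cong (2 * suc n +_) (2*[1+n]C2 n) ⟩
    2 * suc n + suc n * n             ≡⟨ solve 1 (λ n → con 2 :* (con 1 :+ n) :+ (con 1 :+ n) :* n
                                                      := (con 2 :+ n) :* (con 1 :+ n)) refl n ⟩
    suc (suc n) * suc n               ∎
    where open ≡-Reasoning

  ∣++∣ : ∀ {a c} (p : Subset a) (q : Subset c) → ∣ p ++ q ∣ ≡ ∣ p ∣ + ∣ q ∣
  ∣++∣ []            q = refl
  ∣++∣ (outside ∷ p) q = ∣++∣ p q
  ∣++∣ (inside ∷ p)  q = cong suc (∣++∣ p q)

  ∈∁⁅⁆ : {a j : Fin n} → a ≢ j → a ∈ₛ ∁ ⁅ j ⁆
  ∈∁⁅⁆ a≢j = x∉p⇒x∈∁p (x≢y⇒x∉⁅y⁆ a≢j)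

  does≡true⇒ : ∀ {P : Set} (P? : Dec P) → does P? ≡ true → P
  does≡true⇒ (yes p) _ = p

  ≗-lookup⇒≡ : ∀ {A : Set} (u v : Vec A n) → (∀ i → lookup u i ≡ lookup v i) → u ≡ v
  ≗-lookup⇒≡ u v u≗v = trans (sym (tabulate∘lookup u)) (trans (tabulate-cong u≗v) (tabulate∘lookup v))

  concat-injective : ∀ {A : Set} {k} (u v : Vec (Vec A k) n) → concat u ≡ concat v → u ≡ v
  concat-injective []      []      _  = refl
  concat-injective (x ∷ u) (y ∷ v) eq with refl , eq′ ← ++-injective x y eq =
    cong (x ∷_) (concat-injective u v eq′)

  nonempty : (A : Subset n) → 1 ≤ ∣ A ∣ → ∃ λ y → lookup A y ≡ true
  nonempty (true  ∷ A) _  = zero , refl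
  nonempty (false ∷ A) 1≤ = let y , A[y] = nonempty A 1≤ in suc y , A[y]

  nonempty⁻ : (A : Subset n) (y : Fin n) → lookup A y ≡ true → 1 ≤ ∣ A ∣
  nonempty⁻ (true  ∷ A) _       _    = s≤s z≤n
  nonempty⁻ (false ∷ A) (suc y) A[y] = nonempty⁻ A y A[y]

  two-elements : (A : Subset n) → 2 ≤ ∣ A ∣ →
    ∃₂ λ y₁ y₂ → y₁ ≢ y₂ × lookup A y₁ ≡ true × lookup A y₂ ≡ true
  two-elements (true ∷ A) (s≤s 1≤) = let y , A[y] = nonempty A 1≤ in zero , suc y , (λ ()) , refl , A[y]
  two-elements (false ∷ A) 2≤ =
    let y₁ , y₂ , y₁≢y₂ , A[y₁] , A[y₂] = two-elements A 2≤
    in suc y₁ , suc y₂ , y₁≢y₂ ∘ Finₚ.suc-injective , A[y₁] , A[y₂]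

  two-elements⁻ : (A : Subset n) (y₁ y₂ : Fin n) → y₁ ≢ y₂ → lookup A y₁ ≡ true → lookup A y₂ ≡ true → 2 ≤ ∣ A ∣
  two-elements⁻ (a ∷ A) zero zero y₁≢y₂ _ _ = ⊥-elim (y₁≢y₂ refl)
  two-elements⁻ (true ∷ A) zero (suc y₂) _ _ A[y₂] = s≤s (nonempty⁻ A y₂ A[y₂])
  two-elements⁻ (true ∷ A) (suc y₁) zero _ A[y₁] _ = s≤s (nonempty⁻ A y₁ A[y₁])
  two-elements⁻ (true ∷ A) (suc y₁) (suc y₂) y₁≢y₂ A[y₁] A[y₂] =
    m≤n⇒m≤1+n (two-elements⁻ A y₁ y₂ (y₁≢y₂ ∘ cong suc) A[y₁] A[y₂])
  two-elements⁻ (false ∷ A) (suc y₁) (suc y₂) y₁≢y₂ A[y₁] A[y₂] =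
    two-elements⁻ A y₁ y₂ (y₁≢y₂ ∘ cong suc) A[y₁] A[y₂]

  offsets-equal-mod : ∀ {A B u w} .{{_ : NonZero n}} → A % n ≡ B % n → A + u ≡ B + w → u < n → w < n → u ≡ w
  offsets-equal-mod {n} {A} {B} {u} {w} A≡B A+u≡B+w u<n w<n = begin
    u                       ≡⟨ m<n⇒m%n≡m u<n ⟨
    u % n                   ≡⟨ [m+kn]%n≡m%n u (A / n) n ⟨
    (u + (A / n) * n) % n   ≡⟨ cong (_% n) quotients-cancel ⟩
    (w + (B / n) * n) % n   ≡⟨ [m+kn]%n≡m%n w (B / n) n ⟩
    w % n                   ≡⟨ m<n⇒m%n≡m w<n ⟩
    w                       ∎
    where
    open ≡-Reasoning
    quotients-cancel : u + (A / n) * n ≡ w + (B / n) * n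
    quotients-cancel = +-cancelˡ-≡ (A % n) _ _ (begin
      A % n + (u + (A / n) * n)   ≡⟨ cong (A % n +_) (+-comm u _) ⟩
      A % n + ((A / n) * n + u)   ≡⟨ +-assoc (A % n) _ u ⟨
      A % n + (A / n) * n + u     ≡⟨ cong (_+ u) (m≡m%n+[m/n]*n A n) ⟨
      A + u                       ≡⟨ A+u≡B+w ⟩
      B + w                       ≡⟨ cong (_+ w) (m≡m%n+[m/n]*n B n) ⟩
      B % n + (B / n) * n + w     ≡⟨ cong (λ z → z + (B / n) * n + w) A≡B ⟨
      A % n + (B / n) * n + w     ≡⟨ +-assoc (A % n) _ w ⟩
      A % n + ((B / n) * n + w)   ≡⟨ cong (A % n +_) (+-comm _ w) ⟩
      A % n + (w + (B / n) * n)   ∎)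

  avoid-zero-and : (a : Fin (3 + n)) → ∃ λ j → toℕ j < 3 × j ≢ zero × j ≢ a
  avoid-zero-and zero          = suc zero , s≤s (s≤s z≤n) , (λ ()) , (λ ())
  avoid-zero-and (suc zero)    = suc (suc zero) , ≤-refl , (λ ()) , (λ ())
  avoid-zero-and (suc (suc _)) = suc zero , s≤s (s≤s z≤n) , (λ ()) , (λ ())

  avoid-two : (a₁ a₂ : Fin n) → 3 ≤ n → ∃ λ j → toℕ j < 3 × j ≢ a₁ × j ≢ a₂
  avoid-two {suc (suc (suc _))} zero     a₂       _ = avoid-zero-and a₂
  avoid-two {suc (suc (suc _))} (suc a₁) zero     _ =
    let j , j<3 , j≢0 , j≢a₁ = avoid-zero-and (suc a₁) in j , j<3 , j≢a₁ , j≢0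
  avoid-two {suc (suc (suc _))} (suc a₁) (suc a₂) _ = zero , s≤s z≤n , (λ ()) , (λ ())
  avoid-two {suc zero}          _        _        (s≤s ())
  avoid-two {suc (suc zero)}    _        _        (s≤s (s≤s ()))

  distinct⇒2≤ : {y₁ y₂ : Fin n} → y₁ ≢ y₂ → 2 ≤ n
  distinct⇒2≤ {suc zero}    {zero} {zero} y₁≢y₂ = ⊥-elim (y₁≢y₂ refl)
  distinct⇒2≤ {suc (suc _)}                _     = s≤s (s≤s z≤n)

  ∣∣-insert : (A A′ : Subset n) (y₀ : Fin n) → lookup A y₀ ≡ false → lookup A′ y₀ ≡ true →
              (∀ y → y ≢ y₀ → lookup A y ≡ lookup A′ y) → ∣ A′ ∣ ≡ suc ∣ A ∣
  ∣∣-insert (false ∷ A) (true ∷ A′) zero refl refl same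
    with refl ← ≗-lookup⇒≡ A A′ (λ y → same (suc y) (λ ())) = refl
  ∣∣-insert (a ∷ A) (a′ ∷ A′) (suc y₀) fresh added same with same zero (λ ())
  ... | refl = step a (∣∣-insert A A′ y₀ fresh added (λ y y≢y₀ → same (suc y) (y≢y₀ ∘ Finₚ.suc-injective)))
    where
    step : ∀ a → ∣ A′ ∣ ≡ suc ∣ A ∣ → ∣ a ∷ A′ ∣ ≡ suc ∣ a ∷ A ∣
    step true  eq = cong suc eq
    step false eq = eq

  module BlowUp (t : ℕ) where

    -- A subset of the blow-up Fin (m * t) is the concat of its traces on the m fibres.
    Blocks : ℕ → Set
    Blocks m = Vec (Subset t) m

    blockVectors : ∀ m → List (Blocks m)
    blockVectors = vectorsOver (subsets t)

    size : Blocks m → ℕ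
    size []      = 0
    size (A ∷ b) = ∣ A ∣ + size b

    collisions : Blocks m → ℕ
    collisions []      = 0
    collisions (A ∷ b) = (∣ A ∣ ∸ 1) + collisions b

    support : Blocks m → Subset m
    support []      = []
    support (A ∷ b) = (0 <ᵇ ∣ A ∣) ∷ support b

    -- The sum of the fibre indices of the elements: fibre x contributes x · ∣ A_x ∣.
    weight : Blocks m → ℕ
    weight []      = 0
    weight (A ∷ b) = size b + weight b

    ∣concat∣ : (b : Blocks m) → ∣ concat b ∣ ≡ size b
    ∣concat∣ []      = refl
    ∣concat∣ (A ∷ b) = trans (∣++∣ A (concat b)) (cong (∣ A ∣ +_) (∣concat∣ b))

    size≡∣support∣ : (b : Blocks m) → collisions b ≡ 0 → size b ≡ ∣ support b ∣
    size≡∣support∣ []      _ = refl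
    size≡∣support∣ (A ∷ b) c≡0 with ∣ A ∣
    ... | 0 = size≡∣support∣ b c≡0
    ... | 1 = cong suc (size≡∣support∣ b c≡0)
    ... | suc (suc _) with () ← c≡0

    ∑-concat : ∀ m (w : Subset (m * t) → ℕ) →
      ∑[ b ∈ blockVectors m ] w (concat b) ≡ ∑ (subsets (m * t)) w
    ∑-concat zero    w = refl
    ∑-concat (suc m) w = begin
      ∑[ b ∈ blockVectors (suc m) ] w (concat b)
        ≡⟨ ∑-vectorsOver-suc (subsets t) m _ ⟩
      ∑[ A ∈ subsets t ] ∑[ b ∈ blockVectors m ] w (A ++ concat b)
        ≡⟨ ∑-cong (subsets t) (λ A → ∑-concat m (w ∘ (A ++_))) ⟩
      ∑[ A ∈ subsets t ] ∑[ e ∈ subsets (m * t) ] w (A ++ e)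
        ≡⟨ ∑-subsets-++ t (m * t) w ⟨
      ∑ (subsets (t + m * t)) w
        ∎
      where open ≡-Reasoning

    ∑-size : ∀ m r → ∑[ b ∈ blockVectors m ] 𝟙 (size b ≟ r) ≡ (m * t) C r
    ∑-size m r = begin
      ∑[ b ∈ blockVectors m ] 𝟙 (size b ≟ r)
        ≡⟨ ∑-cong (blockVectors m) (λ b → cong (λ s → 𝟙 (s ≟ r)) (sym (∣concat∣ b))) ⟩
      ∑[ b ∈ blockVectors m ] 𝟙 (∣ concat b ∣ ≟ r)
        ≡⟨ ∑-concat m (λ e → 𝟙 (∣ e ∣ ≟ r)) ⟩
      ∑[ e ∈ subsets (m * t) ] 𝟙 (∣ e ∣ ≟ r)
        ≡⟨ ∑-subsets-size (m * t) r ⟩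
      (m * t) C r
        ∎
      where open ≡-Reasoning

    ∑-transversal : ∀ m (Q : Subset m → ℕ) →
      ∑[ b ∈ blockVectors m ] (𝟙 (collisions b ≟ 0) * Q (support b)) ≡ ∑[ g ∈ subsets m ] (t ^ ∣ g ∣ * Q g)
    ∑-transversal zero    Q = refl
    ∑-transversal (suc m) Q = begin
      ∑[ b ∈ blockVectors (suc m) ] (𝟙 (collisions b ≟ 0) * Q (support b))
        ≡⟨ ∑-vectorsOver-suc (subsets t) m _ ⟩
      ∑[ A ∈ subsets t ] ψ ∣ A ∣
        ≡⟨ ∑-subsets-∣∣≤2 t ψ (ψ≥2≡0 ∘ suc) ⟩
      ψ 0 + t * ψ 1 + (t C 2) * ψ 2
        ≡⟨ cong (λ z → ψ 0 + t * ψ 1 + (t C 2) * z) (ψ≥2≡0 0) ⟩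
      ψ 0 + t * ψ 1 + (t C 2) * 0
        ≡⟨ cong (ψ 0 + t * ψ 1 +_) (*-zeroʳ (t C 2)) ⟩
      ψ 0 + t * ψ 1 + 0
        ≡⟨ +-identityʳ _ ⟩
      ψ 0 + t * ψ 1
        ≡⟨ cong₂ _+_ (∑-transversal m (Q ∘ (outside ∷_)))
                     (cong (t *_) (∑-transversal m (Q ∘ (inside ∷_)))) ⟩
      ∑[ g ∈ subsets m ] (t ^ ∣ g ∣ * Q (outside ∷ g)) + t * ∑[ g ∈ subsets m ] (t ^ ∣ g ∣ * Q (inside ∷ g))
        ≡⟨ cong (∑[ g ∈ subsets m ] (t ^ ∣ g ∣ * Q (outside ∷ g)) +_) (trans (sym (∑-distribˡ-* (subsets m) t _))
                              (∑-cong (subsets m) (λ g → sym (*-assoc t (t ^ ∣ g ∣) _)))) ⟩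
      ∑[ g ∈ subsets m ] (t ^ ∣ g ∣ * Q (outside ∷ g)) + ∑[ g ∈ subsets m ] (t ^ suc ∣ g ∣ * Q (inside ∷ g))
        ≡⟨ ∑-subsets-suc m _ ⟨
      ∑[ g ∈ subsets (suc m) ] (t ^ ∣ g ∣ * Q g)
        ∎
      where
      open ≡-Reasoning
      ψ : ℕ → ℕ
      ψ a = ∑[ b ∈ blockVectors m ] (𝟙 ((a ∸ 1) + collisions b ≟ 0) * Q ((0 <ᵇ a) ∷ support b))
      ψ≥2≡0 : ∀ a → ψ (2 + a) ≡ 0
      ψ≥2≡0 _ = ∑-zero (blockVectors m)

    ∑-transversal-size : ∀ m r (Q : Subset m → ℕ) →
      ∑[ b ∈ blockVectors m ] (𝟙 (size b ≟ r) * 𝟙 (collisions b ≟ 0) * Q (support b))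
        ≡ t ^ r * ∑[ g ∈ subsets m ] (𝟙 (∣ g ∣ ≟ r) * Q g)
    ∑-transversal-size m r Q = begin
      ∑[ b ∈ blockVectors m ] (𝟙 (size b ≟ r) * 𝟙 (collisions b ≟ 0) * Q (support b))
        ≡⟨ ∑-cong (blockVectors m) on-support ⟩
      ∑[ b ∈ blockVectors m ] (𝟙 (collisions b ≟ 0) * (𝟙 (∣ support b ∣ ≟ r) * Q (support b)))
        ≡⟨ ∑-transversal m (λ g → 𝟙 (∣ g ∣ ≟ r) * Q g) ⟩
      ∑[ g ∈ subsets m ] (t ^ ∣ g ∣ * (𝟙 (∣ g ∣ ≟ r) * Q g))
        ≡⟨ ∑-cong (subsets m) (λ g → only-size-r ∣ g ∣ (Q g)) ⟩
      ∑[ g ∈ subsets m ] (t ^ r * (𝟙 (∣ g ∣ ≟ r) * Q g))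
        ≡⟨ ∑-distribˡ-* (subsets m) (t ^ r) _ ⟩
      t ^ r * ∑[ g ∈ subsets m ] (𝟙 (∣ g ∣ ≟ r) * Q g)
        ∎
      where
      open ≡-Reasoning
      on-support : ∀ b → 𝟙 (size b ≟ r) * 𝟙 (collisions b ≟ 0) * Q (support b)
                       ≡ 𝟙 (collisions b ≟ 0) * (𝟙 (∣ support b ∣ ≟ r) * Q (support b))
      on-support b with collisions b ≟ 0
      ... | no _    = cong (_* Q (support b)) (*-zeroʳ (𝟙 (size b ≟ r)))
      ... | yes c≡0 = begin
        𝟙 (size b ≟ r) * 1 * Q (support b)           ≡⟨ cong (_* Q (support b)) (*-identityʳ (𝟙 (size b ≟ r))) ⟩
        𝟙 (size b ≟ r) * Q (support b)               ≡⟨ cong (λ s → 𝟙 (s ≟ r) * Q (support b)) (size≡∣support∣ b c≡0) ⟩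
        𝟙 (∣ support b ∣ ≟ r) * Q (support b)        ≡⟨ +-identityʳ _ ⟨
        1 * (𝟙 (∣ support b ∣ ≟ r) * Q (support b))  ∎
      only-size-r : ∀ a q → t ^ a * (𝟙 (a ≟ r) * q) ≡ t ^ r * (𝟙 (a ≟ r) * q)
      only-size-r a q with a ≟ r
      ... | yes refl = refl
      ... | no _     = trans (*-zeroʳ (t ^ a)) (sym (*-zeroʳ (t ^ r)))

    ∑-no-collision : ∀ m r →
      ∑[ b ∈ blockVectors m ] (𝟙 (size b ≟ r) * 𝟙 (collisions b ≟ 0)) ≡ t ^ r * (m C r)
    ∑-no-collision m r = begin
      ∑[ b ∈ blockVectors m ] (𝟙 (size b ≟ r) * 𝟙 (collisions b ≟ 0))
        ≡⟨ ∑-cong (blockVectors m) (λ b → sym (*-identityʳ _)) ⟩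
      ∑[ b ∈ blockVectors m ] (𝟙 (size b ≟ r) * 𝟙 (collisions b ≟ 0) * 1)
        ≡⟨ ∑-transversal-size m r (λ _ → 1) ⟩
      t ^ r * ∑[ g ∈ subsets m ] (𝟙 (∣ g ∣ ≟ r) * 1)
        ≡⟨ cong (t ^ r *_) (trans (∑-cong (subsets m) (λ g → *-identityʳ _)) (∑-subsets-size m r)) ⟩
      t ^ r * (m C r)
        ∎
      where open ≡-Reasoning

    -- Choose the support (m C (r - 1)), its doubled fibre (r - 1), the pair in it (t C 2)
    -- and one point in each of the other r - 2 fibres.
    oneCollisionCount : ℕ → ℕ → ℕ
    oneCollisionCount m r = (t C 2) * t ^ (r ∸ 2) * ((r ∸ 1) * (m C (r ∸ 1)))

    oneCollisionCount-suc : ∀ m r →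
      oneCollisionCount m (2 + r) + t * oneCollisionCount m (1 + r) + (t C 2) * (t ^ r * (m C r))
        ≡ oneCollisionCount (suc m) (2 + r)
    oneCollisionCount-suc m r = begin
      (t C 2) * t ^ r * (suc r * x′) + t * ((t C 2) * t ^ (r ∸ 1) * (r * x)) + (t C 2) * (t ^ r * x)
        ≡⟨ solve 7 (λ c t p q r x x′ → c :* p :* ((con 1 :+ r) :* x′) :+ t :* (c :* q :* (r :* x)) :+ c :* (p :* x)
                                  := c :* p :* ((con 1 :+ r) :* x′) :+ c :* (t :* q :* r) :* x :+ c :* (p :* x))
                 refl (t C 2) t (t ^ r) (t ^ (r ∸ 1)) r x x′ ⟩
      (t C 2) * t ^ r * (suc r * x′) + (t C 2) * (t * t ^ (r ∸ 1) * r) * x + (t C 2) * (t ^ r * x)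
        ≡⟨ cong (λ z → (t C 2) * t ^ r * (suc r * x′) + (t C 2) * z * x + (t C 2) * (t ^ r * x)) (pow-pred r) ⟩
      (t C 2) * t ^ r * (suc r * x′) + (t C 2) * (t ^ r * r) * x + (t C 2) * (t ^ r * x)
        ≡⟨ solve 5 (λ c p r x x′ → c :* p :* ((con 1 :+ r) :* x′) :+ c :* (p :* r) :* x :+ c :* (p :* x)
                                := c :* p :* ((con 1 :+ r) :* (x :+ x′)))
                 refl (t C 2) (t ^ r) r x x′ ⟩
      (t C 2) * t ^ r * (suc r * (x + x′))
        ≡⟨ cong (λ z → (t C 2) * t ^ r * (suc r * z)) (nCk+nC[k+1]≡[n+1]C[k+1] m r) ⟩
      (t C 2) * t ^ r * (suc r * (suc m C suc r))
        ∎
      where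
      open ≡-Reasoning
      x x′ : ℕ
      x  = m C r
      x′ = m C suc r
      pow-pred : ∀ r → t * t ^ (r ∸ 1) * r ≡ t ^ r * r
      pow-pred zero    = trans (*-zeroʳ (t * 1)) (sym (*-zeroʳ 1))
      pow-pred (suc r) = refl

    ∑-one-collision : ∀ m r →
      ∑[ b ∈ blockVectors m ] (𝟙 (size b ≟ r) * 𝟙 (collisions b ≟ 1)) ≡ oneCollisionCount m r
    ∑-one-collision zero    zero          = sym (*-zeroʳ ((t C 2) * 1))
    ∑-one-collision zero    (suc zero)    = sym (*-zeroʳ ((t C 2) * 1))
    ∑-one-collision zero    (suc (suc r)) =
      sym (trans (cong ((t C 2) * t ^ r *_) (*-zeroʳ (suc r))) (*-zeroʳ ((t C 2) * t ^ r)))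
    ∑-one-collision (suc m) r = begin
      ∑[ b ∈ blockVectors (suc m) ] (𝟙 (size b ≟ r) * 𝟙 (collisions b ≟ 1))
        ≡⟨ ∑-vectorsOver-suc (subsets t) m _ ⟩
      ∑[ A ∈ subsets t ] ψ r ∣ A ∣
        ≡⟨ ∑-subsets-∣∣≤2 t (ψ r) (ψ≥3≡0 r) ⟩
      ψ r 0 + t * ψ r 1 + (t C 2) * ψ r 2
        ≡⟨ by-size r ⟩
      oneCollisionCount (suc m) r
        ∎
      where
      open ≡-Reasoning
      ψ : ℕ → ℕ → ℕ
      ψ r a = ∑[ b ∈ blockVectors m ] (𝟙 (a + size b ≟ r) * 𝟙 ((a ∸ 1) + collisions b ≟ 1))
      ψ≥3≡0 : ∀ r a → ψ r (3 + a) ≡ 0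
      ψ≥3≡0 r a = trans (∑-cong (blockVectors m) (λ b → *-zeroʳ (𝟙 (3 + a + size b ≟ r)))) (∑-zero (blockVectors m))
      ψ-suc : ∀ r a → ψ (suc r) (suc a) ≡ ∑[ b ∈ blockVectors m ] (𝟙 (a + size b ≟ r) * 𝟙 ((suc a ∸ 1) + collisions b ≟ 1))
      ψ-suc r a = ∑-cong (blockVectors m) (λ b → cong (_* 𝟙 ((suc a ∸ 1) + collisions b ≟ 1)) (𝟙-suc (a + size b) r))
      by-size : ∀ r → ψ r 0 + t * ψ r 1 + (t C 2) * ψ r 2 ≡ oneCollisionCount (suc m) r
      by-size zero
        rewrite ∑-one-collision m 0 | ∑-zero (blockVectors m) =
        solve 2 (λ c t → c :* con 1 :* con 0 :+ t :* con 0 :+ c :* con 0 := c :* con 1 :* con 0) refl (t C 2) t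
      by-size (suc zero)
        rewrite ∑-one-collision m 1 | ψ-suc 0 0 | ∑-one-collision m 0 | ∑-zero (blockVectors m) =
        solve 2 (λ c t → c :* con 1 :* con 0 :+ t :* (c :* con 1 :* con 0) :+ c :* con 0 := c :* con 1 :* con 0)
              refl (t C 2) t
      by-size (suc (suc r)) = begin
        ψ (2 + r) 0 + t * ψ (2 + r) 1 + (t C 2) * ψ (2 + r) 2
          ≡⟨ cong₂ (λ a b → a + t * b + (t C 2) * ψ (2 + r) 2)
                   (∑-one-collision m (2 + r)) (trans (ψ-suc (1 + r) 0) (∑-one-collision m (1 + r))) ⟩
        oneCollisionCount m (2 + r) + t * oneCollisionCount m (1 + r) + (t C 2) * ψ (2 + r) 2
          ≡⟨ cong (λ z → oneCollisionCount m (2 + r) + t * oneCollisionCount m (1 + r) + (t C 2) * z) no-collision ⟩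
        oneCollisionCount m (2 + r) + t * oneCollisionCount m (1 + r) + (t C 2) * (t ^ r * (m C r))
          ≡⟨ oneCollisionCount-suc m r ⟩
        oneCollisionCount (suc m) (2 + r)
          ∎
        where
        no-collision : ψ (2 + r) 2 ≡ t ^ r * (m C r)
        no-collision = trans (∑-cong (blockVectors m) (λ b → cong₂ _*_ (trans (𝟙-suc (1 + size b) (1 + r)) (𝟙-suc (size b) r))
                                                                     (𝟙-suc (collisions b) 0)))
                             (∑-no-collision m r)

    ∑-by-collisions : ∀ m r →
      ∑[ b ∈ blockVectors m ] (𝟙 (size b ≟ r) * 𝟙 (collisions b ≟ 0))
        + ∑[ b ∈ blockVectors m ] (𝟙 (size b ≟ r) * 𝟙 (collisions b ≟ 1))
        + ∑[ b ∈ blockVectors m ] (𝟙 (size b ≟ r) * 𝟙 (2 ≤? collisions b))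
      ≡ (m * t) C r
    ∑-by-collisions m r = begin
      ∑ bs s₀ + ∑ bs s₁ + ∑ bs s₂                  ≡⟨ cong (_+ ∑ bs s₂) (∑-distrib-+ bs s₀ s₁) ⟨
      ∑[ b ∈ bs ] (s₀ b + s₁ b) + ∑ bs s₂          ≡⟨ ∑-distrib-+ bs _ s₂ ⟨
      ∑[ b ∈ bs ] (s₀ b + s₁ b + s₂ b)             ≡⟨ ∑-cong bs (λ b → classes (𝟙 (size b ≟ r)) (collisions b)) ⟩
      ∑[ b ∈ bs ] 𝟙 (size b ≟ r)                   ≡⟨ ∑-size m r ⟩
      (m * t) C r                                  ∎
      where
      open ≡-Reasoning
      bs : List (Blocks m)
      bs = blockVectors m
      s₀ s₁ s₂ : Blocks m → ℕ
      s₀ b = 𝟙 (size b ≟ r) * 𝟙 (collisions b ≟ 0)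
      s₁ b = 𝟙 (size b ≟ r) * 𝟙 (collisions b ≟ 1)
      s₂ b = 𝟙 (size b ≟ r) * 𝟙 (2 ≤? collisions b)
      classes : ∀ x c → x * 𝟙 (c ≟ 0) + x * 𝟙 (c ≟ 1) + x * 𝟙 (2 ≤? c) ≡ x
      classes x 0             = solve 1 (λ x → x :* con 1 :+ x :* con 0 :+ x :* con 0 := x) refl x
      classes x 1             = solve 1 (λ x → x :* con 0 :+ x :* con 1 :+ x :* con 0 := x) refl x
      classes x (suc (suc _)) = solve 1 (λ x → x :* con 0 :+ x :* con 0 :+ x :* con 1 := x) refl x

    _[_,_] : Blocks m → Fin m → Fin t → Bool
    b [ x , y ] = lookup (lookup b x) y

    module Coordinates (m : ℕ) where

      fibre : Fin (m * t) → Fin m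
      fibre = quotient t

      slot : Fin (m * t) → Fin t
      slot = remainder {m} t

      fibre-combine : (x : Fin m) (y : Fin t) → fibre (combine x y) ≡ x
      fibre-combine x y = cong proj₁ (remQuot-combine x y)

      slot-combine : (x : Fin m) (y : Fin t) → slot (combine x y) ≡ y
      slot-combine x y = cong proj₂ (remQuot-combine x y)

      combine-fibre-slot : (v : Fin (m * t)) → combine (fibre v) (slot v) ≡ v
      combine-fibre-slot v = combine-remQuot {m} t v

      coordinates-injective : {u v : Fin (m * t)} → fibre u ≡ fibre v → slot u ≡ slot v → u ≡ v
      coordinates-injective {u} {v} ≡x ≡y =
        trans (sym (combine-fibre-slot u)) (trans (cong₂ combine ≡x ≡y) (combine-fibre-slot v))

      lookup-concat-coordinates : (b : Blocks m) (v : Fin (m * t)) → lookup (concat b) v ≡ b [ fibre v , slot v ]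
      lookup-concat-coordinates b v =
        trans (cong (lookup (concat b)) (sym (combine-fibre-slot v))) (lookup-concat b (fibre v) (slot v))

    collision⁻ : (b : Blocks m) → 1 ≤ collisions b →
      ∃ λ x → ∃₂ λ y₁ y₂ → y₁ ≢ y₂ × b [ x , y₁ ] ≡ true × b [ x , y₂ ] ≡ true
    collision⁻ (A ∷ b) 1≤ with ∣ A ∣ in ∣A∣≡
    ... | 0           = let x , w = collision⁻ b 1≤ in suc x , w
    ... | 1           = let x , w = collision⁻ b 1≤ in suc x , w
    ... | suc (suc _) = zero , two-elements A (subst (2 ≤_) (sym ∣A∣≡) (s≤s (s≤s z≤n)))

    collision⁺ : (b : Blocks m) (x : Fin m) (y₁ y₂ : Fin t) → y₁ ≢ y₂ →
                 b [ x , y₁ ] ≡ true → b [ x , y₂ ] ≡ true → 1 ≤ collisions b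
    collision⁺ (A ∷ b) zero y₁ y₂ y₁≢y₂ A[y₁] A[y₂] =
      ≤-trans (∸-monoˡ-≤ 1 (two-elements⁻ A y₁ y₂ y₁≢y₂ A[y₁] A[y₂])) (m≤m+n _ (collisions b))
    collision⁺ (A ∷ b) (suc x) y₁ y₂ y₁≢y₂ b[y₁] b[y₂] =
      ≤-trans (collision⁺ b x y₁ y₂ y₁≢y₂ b[y₁] b[y₂]) (m≤n+m (collisions b) _)

    support⁻ : (b : Blocks m) (x : Fin m) → lookup (support b) x ≡ true → ∃ λ y → b [ x , y ] ≡ true
    support⁻ (A ∷ b) zero    x∈ with ∣ A ∣ in ∣A∣≡
    ... | suc _ = nonempty A (subst (1 ≤_) (sym ∣A∣≡) (s≤s z≤n))
    support⁻ (A ∷ b) (suc x) x∈ = support⁻ b x x∈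

    support⁺ : (b : Blocks m) (x : Fin m) (y : Fin t) → b [ x , y ] ≡ true → lookup (support b) x ≡ true
    support⁺ (A ∷ b) zero    y A[y] with ∣ A ∣ | nonempty⁻ A y A[y]
    ... | suc _ | _ = refl
    support⁺ (A ∷ b) (suc x) y b[y] = support⁺ b x y b[y]

    record Extends (b b′ : Blocks m) (x₀ : Fin m) (y₀ : Fin t) : Set where
      field
        fresh : b [ x₀ , y₀ ] ≡ false
        added : b′ [ x₀ , y₀ ] ≡ true
        same  : ∀ x y → ¬ (x ≡ x₀ × y ≡ y₀) → b [ x , y ] ≡ b′ [ x , y ]

    private
      module _ {A A′ : Subset t} {b b′ : Blocks m} {y₀ : Fin t} where
        Extends-here : Extends (A ∷ b) (A′ ∷ b′) zero y₀ → b ≡ b′ × ∣ A′ ∣ ≡ suc ∣ A ∣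
        Extends-here ext =
          ≗-lookup⇒≡ b b′ (λ x → ≗-lookup⇒≡ _ _ λ y → same (suc x) y λ ()) ,
          ∣∣-insert A A′ y₀ fresh added (λ y y≢y₀ → same zero y (y≢y₀ ∘ proj₂))
          where open Extends ext

        Extends-there : ∀ {x₀} → Extends (A ∷ b) (A′ ∷ b′) (suc x₀) y₀ → A ≡ A′ × Extends b b′ x₀ y₀
        Extends-there ext =
          ≗-lookup⇒≡ A A′ (λ y → same zero y (λ ())) ,
          record { fresh = fresh ; added = added
                 ; same = λ x y ≢ → same (suc x) y (λ (x≡ , y≡) → ≢ (Finₚ.suc-injective x≡ , y≡)) }
          where open Extends ext

    Extends⇒size : (b b′ : Blocks m) {x₀ : Fin m} {y₀ : Fin t} → Extends b b′ x₀ y₀ → size b′ ≡ suc (size b)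
    Extends⇒size (A ∷ b) (A′ ∷ b′) {zero} ext with refl , ∣A′∣≡ ← Extends-here ext = cong (_+ size b) ∣A′∣≡
    Extends⇒size (A ∷ b) (A′ ∷ b′) {suc x₀} ext with refl , ext′ ← Extends-there ext =
      trans (cong (∣ A ∣ +_) (Extends⇒size b b′ ext′)) (+-suc ∣ A ∣ (size b))

    Extends⇒collisions : (b b′ : Blocks m) {x₀ : Fin m} {y₀ : Fin t} → Extends b b′ x₀ y₀ →
                         collisions b ≤ collisions b′ × collisions b′ ≤ suc (collisions b)
    Extends⇒collisions (A ∷ b) (A′ ∷ b′) {zero} ext with refl , ∣A′∣≡ ← Extends-here ext
      rewrite ∣A′∣≡ = +-monoˡ-≤ (collisions b) (pred-≤ ∣ A ∣) , pred-+ ∣ A ∣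
      where
      pred-≤ : ∀ a → a ∸ 1 ≤ a
      pred-≤ a = m∸n≤m a 1
      pred-+ : ∀ a → a + collisions b ≤ suc ((a ∸ 1) + collisions b)
      pred-+ zero    = n≤1+n (collisions b)
      pred-+ (suc a) = ≤-refl
    Extends⇒collisions (A ∷ b) (A′ ∷ b′) {suc x₀} ext with refl , ext′ ← Extends-there ext =
      let lower , upper = Extends⇒collisions b b′ ext′
      in +-monoʳ-≤ (∣ A ∣ ∸ 1) lower ,
         ≤-trans (+-monoʳ-≤ (∣ A ∣ ∸ 1) upper) (≤-reflexive (+-suc (∣ A ∣ ∸ 1) (collisions b)))

    Extends⇒weight : (b b′ : Blocks m) {x₀ : Fin m} {y₀ : Fin t} → Extends b b′ x₀ y₀ →
                     weight b′ ≡ weight b + toℕ x₀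
    Extends⇒weight (A ∷ b) (A′ ∷ b′) {zero} ext with refl , _ ← Extends-here ext = sym (+-identityʳ _)
    Extends⇒weight (A ∷ b) (A′ ∷ b′) {suc x₀} ext with refl , ext′ ← Extends-there ext = begin
      size b′ + weight b′                  ≡⟨ cong₂ _+_ (Extends⇒size b b′ ext′) (Extends⇒weight b b′ ext′) ⟩
      suc (size b) + (weight b + toℕ x₀)   ≡⟨ cong suc (+-assoc (size b) (weight b) (toℕ x₀)) ⟨
      suc (size b + weight b + toℕ x₀)     ≡⟨ +-suc (size b + weight b) (toℕ x₀) ⟨
      size b + weight b + suc (toℕ x₀)     ∎
      where open ≡-Reasoning

    module _ {r m : ℕ} .{{_ : NonZero m}} where

      heavyCount : ℕ → ℕ
      heavyCount c = ∑[ b ∈ blockVectors m ] (𝟙 (size b ≟ r) * 𝟙 (2 ≤? collisions b) * 𝟙 (c ≟ weight b % m))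

      ∑-heavyCount : ∑[ c ∈ downFrom m ] heavyCount c ≡ ∑[ b ∈ blockVectors m ] (𝟙 (size b ≟ r) * 𝟙 (2 ≤? collisions b))
      ∑-heavyCount = begin
        ∑[ c ∈ downFrom m ] heavyCount c
          ≡⟨ ∑-comm (downFrom m) (blockVectors m) _ ⟩
        ∑[ b ∈ blockVectors m ] ∑[ c ∈ downFrom m ] (heavy b * 𝟙 (c ≟ weight b % m))
          ≡⟨ ∑-cong (blockVectors m) (λ b → ∑-distribˡ-* (downFrom m) (heavy b) _) ⟩
        ∑[ b ∈ blockVectors m ] (heavy b * ∑[ c ∈ downFrom m ] 𝟙 (c ≟ weight b % m))
          ≡⟨ ∑-cong (blockVectors m) (λ b → cong (heavy b *_) (one-residue (weight b))) ⟩
        ∑[ b ∈ blockVectors m ] (heavy b * 1)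
          ≡⟨ ∑-cong (blockVectors m) (λ b → *-identityʳ (heavy b)) ⟩
        ∑[ b ∈ blockVectors m ] heavy b
          ∎
        where
        open ≡-Reasoning
        heavy : Blocks m → ℕ
        heavy b = 𝟙 (size b ≟ r) * 𝟙 (2 ≤? collisions b)
        one-residue : ∀ w → ∑[ c ∈ downFrom m ] 𝟙 (c ≟ w % m) ≡ 1
        one-residue w = ∑-≟-unique _≟_ (Unique.downFrom⁺ m) (∈-downFrom⁺ (m%n<n w m))

      module _ (G : Hypergraph r m) (c : ℕ) where
        open Coordinates m
        open import Data.List.Membership.DecPropositional (≡-dec {n = m} _≟ᵇ_) using (_∈?_)

        Transversal : Blocks m → Set
        Transversal b = collisions b ≡ 0 × support b ∈ edges G

        Heavy : Blocks m → Set
        Heavy b = 2 ≤ collisions b × c ≡ weight b % m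

        IsBlowUpEdge : Blocks m → Set
        IsBlowUpEdge b = size b ≡ r × (Transversal b ⊎ Heavy b)

        isBlowUpEdge? : ∀ b → Dec (IsBlowUpEdge b)
        isBlowUpEdge? b = size b ≟ r ×-dec ((collisions b ≟ 0 ×-dec support b ∈? edges G)
                                            ⊎-dec (2 ≤? collisions b ×-dec c ≟ weight b % m))

        blowUpBlocks : List (Blocks m)
        blowUpBlocks = filter isBlowUpEdge? (blockVectors m)

        ∈-blowUp⁻ : ∀ {e} → e ∈ map concat blowUpBlocks → ∃ λ b → IsBlowUpEdge b × e ≡ concat b
        ∈-blowUp⁻ e∈ = let b , b∈ , e≡ = ∈-map⁻ concat e∈ in
          b , proj₂ (∈-filter⁻ isBlowUpEdge? {xs = blockVectors m} b∈) , e≡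

        blowUp : Hypergraph r (m * t)
        blowUp = record
          { edges   = map concat blowUpBlocks
          ; unique  = Unique.map⁺ (concat-injective _ _)
                        (Unique.filter⁺ isBlowUpEdge? (vectorsOver-unique (subsets-unique t) m))
          ; uniform = All.tabulate λ e∈ → let b , edge , e≡ = ∈-blowUp⁻ e∈ in
                        trans (cong ∣_∣ e≡) (trans (∣concat∣ b) (proj₁ edge))
          }

        collision⇒Heavy : ∀ {b} → IsBlowUpEdge b → 1 ≤ collisions b → Heavy b
        collision⇒Heavy (_ , inj₂ heavy)        _  = heavy
        collision⇒Heavy (_ , inj₁ (c≡0 , _)) 1≤ with () ← subst (1 ≤_) c≡0 1≤

        module Embedding (f : Fin (suc r) → Fin (m * t)) (f-inj : Injective _≡_ _≡_ f) where
          π : Fin (suc r) → Fin m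
          π a = fibre (f a)

          σ : Fin (suc r) → Fin t
          σ a = slot (f a)

          image⁻ : ∀ {h} (b : Blocks m) x y → IsImage f h (concat b) → b [ x , y ] ≡ true →
                   ∃ λ a → a ∈ₛ h × f a ≡ combine x y
          image⁻ b x y img b[x,y] =
            Equivalence.to (img (combine x y)) (lookup⇒[]= _ (concat b) (trans (lookup-concat b x y) b[x,y]))

          image⁺ : ∀ {h} (b : Blocks m) a → IsImage f h (concat b) → a ∈ₛ h → b [ π a , σ a ] ≡ true
          image⁺ b a img a∈h =
            trans (sym (lookup-concat-coordinates b (f a))) ([]=⇒lookup (Equivalence.from (img (f a)) (a , a∈h , refl)))

          module Injective-on-fibres (π-inj : Injective _≡_ _≡_ π) where

            no-collision : ∀ {h} (b : Blocks m) → IsImage f h (concat b) → ¬ (1 ≤ collisions b)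
            no-collision b img 1≤ =
              let x , y₁ , y₂ , y₁≢y₂ , b[y₁] , b[y₂] = collision⁻ b 1≤
                  a₁ , _ , fa₁≡ = image⁻ b x y₁ img b[y₁]
                  a₂ , _ , fa₂≡ = image⁻ b x y₂ img b[y₂]
                  a₁≡a₂ = π-inj (trans (cong fibre fa₁≡) (trans (fibre-combine x y₁)
                                     (sym (trans (cong fibre fa₂≡) (fibre-combine x y₂)))))
              in y₁≢y₂ (begin
                y₁                   ≡⟨ slot-combine x y₁ ⟨
                slot (combine x y₁)  ≡⟨ cong slot fa₁≡ ⟨
                σ a₁                 ≡⟨ cong σ a₁≡a₂ ⟩
                σ a₂                 ≡⟨ cong slot fa₂≡ ⟩
                slot (combine x y₂)  ≡⟨ slot-combine x y₂ ⟩
                y₂                   ∎)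
              where open ≡-Reasoning

            support-image : ∀ {h} {b : Blocks m} → IsImage f h (concat b) → IsImage π h (support b)
            support-image {h} {b} img x = mk⇔ to from
              where
              to : x ∈ₛ support b → ∃ λ a → a ∈ₛ h × π a ≡ x
              to x∈ = let y , b[x,y] = support⁻ b x ([]=⇒lookup x∈)
                          a , a∈h , fa≡ = image⁻ b x y img b[x,y]
                      in a , a∈h , trans (cong fibre fa≡) (fibre-combine x y)
              from : (∃ λ a → a ∈ₛ h × π a ≡ x) → x ∈ₛ support b
              from (a , a∈h , refl) = lookup⇒[]= _ (support b) (support⁺ b (π a) (σ a) (image⁺ b a img a∈h))

            project : ∀ {h} → Any (IsImage f h) (edges blowUp) → Any (IsImage π h) (edges G)
            project any with e , e∈ , img ← find any with ∈-blowUp⁻ e∈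
            ... | b , (_ , inj₁ (_ , g∈)) , refl = lose g∈ (support-image img)
            ... | b , (_ , inj₂ (2≤ , _)) , refl = ⊥-elim (no-collision b img (≤-trans (s≤s z≤n) 2≤))

          module Shared-fibre (k≤r+1 : suc t ≤ suc r)
                              (f-edges : All (λ h → Any (IsImage f h) (edges blowUp)) (H-edges r (suc t))) where

            edgeBlocks : ∀ j → toℕ j < suc t → ∃ λ b → IsBlowUpEdge b × IsImage f (∁ ⁅ j ⁆) (concat b)
            edgeBlocks j j<k
              with e , e∈ , img ← find (All.lookup f-edges (∈-map⁺ (λ j → ∁ ⁅ j ⁆)
                                                          (∈-filter⁺ (λ j → toℕ j <? suc t) (∈-allFin j) j<k)))
              with b , edge , refl ← ∈-blowUp⁻ e∈ = b , edge , img

            occupied? : (x : Fin m) (y : Fin t) → Dec (∃ λ a → f a ≡ combine x y)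
            occupied? x y = any? λ a → f a Fin.≟ combine x y

            imageBlocks : Blocks m
            imageBlocks = tabulate λ x → tabulate λ y → does (occupied? x y)

            imageBlocks-lookup : (x : Fin m) (y : Fin t) → imageBlocks [ x , y ] ≡ does (occupied? x y)
            imageBlocks-lookup x y =
              trans (cong (λ A → lookup A y) (lookup∘tabulate (λ x → tabulate λ y → does (occupied? x y)) x))
                    (lookup∘tabulate (λ y → does (occupied? x y)) y)

            occupant : (x : Fin m) (y : Fin t) → imageBlocks [ x , y ] ≡ true → ∃ λ a → f a ≡ combine x y
            occupant x y S[x,y] = does≡true⇒ (occupied? x y) (trans (sym (imageBlocks-lookup x y)) S[x,y])

            edge-Extends : ∀ j (b : Blocks m) → IsImage f (∁ ⁅ j ⁆) (concat b) → Extends b imageBlocks (π j) (σ j)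
            edge-Extends j b img = record { fresh = fresh ; added = added ; same = same }
              where
              f-j≡ : f j ≡ combine (π j) (σ j)
              f-j≡ = sym (combine-fibre-slot (f j))

              fresh : b [ π j , σ j ] ≡ false
              fresh with b [ π j , σ j ] in b[j]
              ... | false = refl
              ... | true with a , a∈ , fa≡ ← image⁻ b (π j) (σ j) img b[j] with refl ← f-inj (trans fa≡ (sym f-j≡)) =
                ⊥-elim (x∈p⇒x∉∁p (x∈⁅x⁆ a) a∈)

              added : imageBlocks [ π j , σ j ] ≡ true
              added = trans (imageBlocks-lookup (π j) (σ j)) (dec-true (occupied? _ _) (j , f-j≡))

              same : (x : Fin m) (y : Fin t) → ¬ (x ≡ π j × y ≡ σ j) → b [ x , y ] ≡ imageBlocks [ x , y ]
              same x y ≢j = ⇔→≡ (mk⇔ to from)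
                where
                to : b [ x , y ] ≡ true → imageBlocks [ x , y ] ≡ true
                to b[x,y] = let a , _ , fa≡ = image⁻ b x y img b[x,y] in
                  trans (imageBlocks-lookup x y) (dec-true (occupied? x y) (a , fa≡))
                from : imageBlocks [ x , y ] ≡ true → b [ x , y ] ≡ true
                from S[x,y] with a , fa≡ ← occupant x y S[x,y] =
                  subst₂ (λ x y → b [ x , y ] ≡ true) π-a≡ σ-a≡ (image⁺ b a img (∈∁⁅⁆ a≢j))
                  where
                  π-a≡ : π a ≡ x
                  π-a≡ = trans (cong fibre fa≡) (fibre-combine x y)
                  σ-a≡ : σ a ≡ y
                  σ-a≡ = trans (cong slot fa≡) (slot-combine x y)
                  a≢j : a ≢ j
                  a≢j refl = ≢j (sym π-a≡ , sym σ-a≡)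

            module _ (S-heavy : 2 ≤ collisions imageBlocks) where

              weight-split : ∀ j → toℕ j < suc t → ∃ λ w → c ≡ w % m × weight imageBlocks ≡ w + toℕ (π j)
              weight-split j j<k with b , edge , img ← edgeBlocks j j<k =
                let ext = edge-Extends j b img
                    1≤collisions = s≤s⁻¹ (≤-trans S-heavy (proj₂ (Extends⇒collisions b imageBlocks ext)))
                in weight b , proj₂ (collision⇒Heavy edge 1≤collisions) , Extends⇒weight b imageBlocks ext

              -- Modulo m, toℕ (π j) ≡ weight imageBlocks - c for every j < k.
              same-fibre : ∀ j j′ → toℕ j < suc t → toℕ j′ < suc t → π j ≡ π j′
              same-fibre j j′ j<k j′<k with w , c≡w , W≡ ← weight-split j j<k | w′ , c≡w′ , W≡′ ← weight-split j′ j′<k =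
                toℕ-injective (offsets-equal-mod (trans (sym c≡w) c≡w′) (trans (sym W≡) W≡′) (toℕ<n (π j)) (toℕ<n (π j′)))

            module _ {a₁ a₂} (a₁≢a₂ : a₁ ≢ a₂) (π≡ : π a₁ ≡ π a₂) where

              σ≢ : σ a₁ ≢ σ a₂
              σ≢ σ≡ = a₁≢a₂ (f-inj (coordinates-injective π≡ σ≡))

              3≤k : 3 ≤ suc t
              3≤k = s≤s (distinct⇒2≤ σ≢)

              shared-fibre⇒heavy : 2 ≤ collisions imageBlocks
              shared-fibre⇒heavy
                with j₀ , j₀<3 , j₀≢a₁ , j₀≢a₂ ← avoid-two a₁ a₂ (≤-trans 3≤k k≤r+1)
                with b₀ , edge₀ , img₀ ← edgeBlocks j₀ (≤-trans j₀<3 3≤k) =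
                ≤-trans (proj₁ (collision⇒Heavy edge₀ 1≤collisions))
                        (proj₁ (Extends⇒collisions b₀ imageBlocks (edge-Extends j₀ b₀ img₀)))
                where
                1≤collisions : 1 ≤ collisions b₀
                1≤collisions = collision⁺ b₀ (π a₁) (σ a₁) (σ a₂) σ≢ (image⁺ b₀ a₁ img₀ (∈∁⁅⁆ (j₀≢a₁ ∘ sym)))
                                 (subst (λ x → b₀ [ x , σ a₂ ] ≡ true) (sym π≡) (image⁺ b₀ a₂ img₀ (∈∁⁅⁆ (j₀≢a₂ ∘ sym))))

              vertex : Fin (suc t) → Fin (suc r)
              vertex i = inject≤ i k≤r+1

              vertex<k : ∀ i → toℕ (vertex i) < suc t
              vertex<k i = subst (_< suc t) (sym (toℕ-inject≤ i k≤r+1)) (toℕ<n i)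

              -- The k = t + 1 vertices j < k all lie in one fibre of size t.
              shared-fibre-impossible : ⊥
              shared-fibre-impossible with i , i′ , i<i′ , σ≡ ← pigeonhole (n<1+n t) (σ ∘ vertex) =
                Finₚ.<-irrefl (inject≤-injective k≤r+1 k≤r+1 i i′ (f-inj (coordinates-injective π≡′ σ≡))) i<i′
                where
                π≡′ : π (vertex i) ≡ π (vertex i′)
                π≡′ = same-fibre shared-fibre⇒heavy (vertex i) (vertex i′) (vertex<k i) (vertex<k i′)

        blowUp-free : suc t ≤ suc r → HFree (suc t) G → HFree (suc t) blowUp
        blowUp-free k≤r+1 G-free (f , f-inj , f-edges) = G-free (π , π-inj , All.map project f-edges)
          where
          open Embedding f f-inj
          π-inj : Injective _≡_ _≡_ π
          π-inj {a₁} {a₂} π≡ with a₁ Fin.≟ a₂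
          ... | yes a₁≡a₂ = a₁≡a₂
          ... | no  a₁≢a₂ = ⊥-elim (Shared-fibre.shared-fibre-impossible k≤r+1 f-edges a₁≢a₂ π≡)
          open Injective-on-fibres π-inj

        ∥blowUp∥ : ∥ blowUp ∥ ≡ t ^ r * ∥ G ∥ + heavyCount c
        ∥blowUp∥ = begin
          length (map concat blowUpBlocks)       ≡⟨ length-map concat blowUpBlocks ⟩
          length blowUpBlocks                    ≡⟨ length-filter≡∑𝟙 isBlowUpEdge? (blockVectors m) ⟩
          ∑[ b ∈ bs ] 𝟙 (isBlowUpEdge? b)
            ≡⟨ ∑-cong bs (λ b → 𝟙-×-⊎ (size b ≟ r) (collisions b ≟ 0) (support b ∈? edges G)
                                        (2 ≤? collisions b) (c ≟ weight b % m) (λ (c≡0 , 2≤c) → disjoint c≡0 2≤c)) ⟩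
          ∑[ b ∈ bs ] (transversal b + heavy b)  ≡⟨ ∑-distrib-+ bs transversal heavy ⟩
          ∑ bs transversal + heavyCount c        ≡⟨ cong (_+ heavyCount c) transversal-count ⟩
          t ^ r * ∥ G ∥ + heavyCount c           ∎
          where
          open ≡-Reasoning
          bs : List (Blocks m)
          bs = blockVectors m
          transversal heavy : Blocks m → ℕ
          transversal b = 𝟙 (size b ≟ r) * 𝟙 (collisions b ≟ 0) * 𝟙 (support b ∈? edges G)
          heavy b = 𝟙 (size b ≟ r) * 𝟙 (2 ≤? collisions b) * 𝟙 (c ≟ weight b % m)
          disjoint : ∀ {x} → x ≡ 0 → ¬ (2 ≤ x)
          disjoint refl ()
          edges-have-size-r : ∀ g → 𝟙 (∣ g ∣ ≟ r) * 𝟙 (g ∈? edges G) ≡ 𝟙 (g ∈? edges G)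
          edges-have-size-r g with g ∈? edges G
          ... | no _   = *-zeroʳ (𝟙 (∣ g ∣ ≟ r))
          ... | yes g∈ with ∣ g ∣ ≟ r
          ...   | yes _    = refl
          ...   | no ∣g∣≢r = ⊥-elim (∣g∣≢r (All.lookup (uniform G) g∈))
          transversal-count : ∑ bs transversal ≡ t ^ r * ∥ G ∥
          transversal-count = begin
            ∑ bs transversal
              ≡⟨ ∑-transversal-size m r (λ g → 𝟙 (g ∈? edges G)) ⟩
            t ^ r * ∑[ g ∈ subsets m ] (𝟙 (∣ g ∣ ≟ r) * 𝟙 (g ∈? edges G))
              ≡⟨ cong (t ^ r *_) (∑-cong (subsets m) edges-have-size-r) ⟩
            t ^ r * ∑[ g ∈ subsets m ] 𝟙 (g ∈? edges G)
              ≡⟨ cong (t ^ r *_) (∑-∈? (≡-dec _≟ᵇ_) (subsets-unique m) ∈-subsets (unique G)) ⟩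
            t ^ r * ∥ G ∥
              ∎

    blowUp-step : ∀ {r m} .{{_ : NonZero m}} → suc t ≤ suc r → (G : Hypergraph r m) → HFree (suc t) G →
      ∃ λ (G′ : Hypergraph r (m * t)) → HFree (suc t) G′ ×
        m * (t ^ r * ∥ G ∥) + (m * t) C r ≤ m * ∥ G′ ∥ + t ^ r * (m C r) + oneCollisionCount m r
    blowUp-step {r} {m@(suc m′)} k≤r+1 G G-free with c , ∑≤ ← average≤max m′ (downFrom m′) (heavyCount {r}) =
      blowUp G c , blowUp-free G c k≤r+1 G-free , (begin
        m * (t ^ r * ∥ G ∥) + (m * t) C r
          ≡⟨ cong (m * (t ^ r * ∥ G ∥) +_) (∑-by-collisions m r) ⟨
        m * (t ^ r * ∥ G ∥) + (N₀ + N₁ + N₂)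
          ≡⟨ cong₂ (λ x y → m * (t ^ r * ∥ G ∥) + (x + y + N₂)) (∑-no-collision m r) (∑-one-collision m r) ⟩
        m * (t ^ r * ∥ G ∥) + (t ^ r * (m C r) + oneCollisionCount m r + N₂)
          ≤⟨ +-monoʳ-≤ (m * (t ^ r * ∥ G ∥)) (+-monoʳ-≤ (t ^ r * (m C r) + oneCollisionCount m r) N₂≤) ⟩
        m * (t ^ r * ∥ G ∥) + (t ^ r * (m C r) + oneCollisionCount m r + m * heavyCount c)
          ≡⟨ solve 5 (λ a b d h m → m :* a :+ (b :+ d :+ m :* h) := m :* (a :+ h) :+ b :+ d)
                     refl (t ^ r * ∥ G ∥) (t ^ r * (m C r)) (oneCollisionCount m r) (heavyCount c) m ⟩
        m * (t ^ r * ∥ G ∥ + heavyCount c) + t ^ r * (m C r) + oneCollisionCount m r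
          ≡⟨ cong (λ e → m * e + t ^ r * (m C r) + oneCollisionCount m r) (∥blowUp∥ G c) ⟨
        m * ∥ blowUp G c ∥ + t ^ r * (m C r) + oneCollisionCount m r
          ∎)
      where
      open ≤-Reasoning
      N₀ N₁ N₂ : ℕ
      N₀ = ∑[ b ∈ blockVectors m ] (𝟙 (size b ≟ r) * 𝟙 (collisions b ≟ 0))
      N₁ = ∑[ b ∈ blockVectors m ] (𝟙 (size b ≟ r) * 𝟙 (collisions b ≟ 1))
      N₂ = ∑[ b ∈ blockVectors m ] (𝟙 (size b ≟ r) * 𝟙 (2 ≤? collisions b))
      N₂≤ : N₂ ≤ m * heavyCount c
      N₂≤ = ≤-trans (≤-reflexive (sym (∑-heavyCount {r})))
                    (subst (λ l → ∑ (downFrom m) (heavyCount {r}) ≤ l * heavyCount {r} c) (length-downFrom m) ∑≤)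

module Rationals where

  open import Data.Nat as ℕ using (zero; suc; _∸_; _^_; NonZero)
  import Data.Nat.Properties as ℕ
  open import Data.Nat.Combinatorics using (_C_)
  open import Data.Nat.Coprimality using (1-coprimeTo) renaming (sym to coprime-sym)
  open import Data.Integer using (+_; +≤+) renaming (_+_ to _+ℤ_; _≤_ to _≤ℤ_)
  import Data.Integer.Properties as ℤ
  open import Data.Rational using (ℚ; mkℚ; _/_; 0ℚ; 1ℚ; _+_; _*_; _-_; -_; _≤_; *≤*; 1/_; NonNegative)
  open import Data.Rational.Properties
    using (↥p/↧p≡p; *-inverseʳ; normalize-nonNeg; *-zeroʳ; *-identityʳ; *-identityˡ; *-assoc; *-distribˡ-+;
           ≤-trans; +-monoˡ-≤; *-monoʳ-≤-nonNeg; *-monoˡ-≤-nonNeg)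
  open import Data.Rational.Solver using (module +-*-Solver)
  open +-*-Solver using (solve; _:+_; _:*_; _:-_; :-_; _:=_; con)
  open import Data.Product using (Σ; _×_; _,_)
  open import Relation.Binary.PropositionalEquality
    using (_≡_; refl; sym; trans; cong; cong₂; subst; subst₂; module ≡-Reasoning)
  open Combinatorics using (2*[1+n]C2)

  private
    ℚ[]-normal : ∀ a → ℚ[ a ] ≡ mkℚ (+ a) 0 (coprime-sym (1-coprimeTo a))
    ℚ[]-normal a = ↥p/↧p≡p (mkℚ (+ a) 0 (coprime-sym (1-coprimeTo a)))

  ℚ[]-homo-+ : ∀ a b → ℚ[ a ℕ.+ b ] ≡ ℚ[ a ] + ℚ[ b ]
  ℚ[]-homo-+ a b rewrite ℚ[]-normal a | ℚ[]-normal b =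
    cong (_/ 1) (sym (cong₂ _+ℤ_ (ℤ.*-identityʳ (+ a)) (ℤ.*-identityʳ (+ b))))

  ℚ[]-homo-* : ∀ a b → ℚ[ a ℕ.* b ] ≡ ℚ[ a ] * ℚ[ b ]
  ℚ[]-homo-* a b rewrite ℚ[]-normal a | ℚ[]-normal b = cong (_/ 1) (sym (ℤ.+◃n≡+n (a ℕ.* b)))

  ℚ[]-mono-≤ : ∀ {a b} → a ℕ.≤ b → ℚ[ a ] ≤ ℚ[ b ]
  ℚ[]-mono-≤ {a} {b} a≤b rewrite ℚ[]-normal a | ℚ[]-normal b =
    *≤* (subst₂ _≤ℤ_ (sym (ℤ.*-identityʳ (+ a))) (sym (ℤ.*-identityʳ (+ b))) (+≤+ a≤b))

  ℚ[]-nonNeg : ∀ a → NonNegative ℚ[ a ]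
  ℚ[]-nonNeg a = normalize-nonNeg a 1

  -- The reciprocal as used by _/ℕ_, with the same junk value at 0.
  1/ℕ : ℕ → ℚ
  1/ℕ zero    = 0ℚ
  1/ℕ (suc a) = + 1 / suc a

  /ℕ-≡-*1/ℕ : ∀ x a → x /ℕ a ≡ x * 1/ℕ a
  /ℕ-≡-*1/ℕ x zero    = sym (*-zeroʳ x)
  /ℕ-≡-*1/ℕ x (suc a) = refl

  1/ℕ-nonNeg : ∀ a → NonNegative (1/ℕ a)
  1/ℕ-nonNeg zero    = normalize-nonNeg 0 1
  1/ℕ-nonNeg (suc a) = normalize-nonNeg 1 (suc a)

  ℚ[]*1/ℕ : ∀ a .{{_ : ℕ.NonZero a}} → ℚ[ a ] * 1/ℕ a ≡ 1ℚ
  ℚ[]*1/ℕ (suc a) rewrite ℚ[]-normal (suc a) =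
    trans (cong (q *_) (↥p/↧p≡p (1/ q))) (*-inverseʳ q)
    where q = mkℚ (+ suc a) 0 (coprime-sym (1-coprimeTo (suc a)))

  1/ℕ-* : ∀ a b .{{_ : ℕ.NonZero a}} .{{_ : ℕ.NonZero b}} → 1/ℕ (a ℕ.* b) ≡ 1/ℕ a * 1/ℕ b
  1/ℕ-* a@(suc _) b@(suc _) = begin
    1/ℕ (a ℕ.* b)                                            ≡⟨ *-identityʳ _ ⟨
    1/ℕ (a ℕ.* b) * 1ℚ                                       ≡⟨ cong (1/ℕ (a ℕ.* b) *_) ones ⟨
    1/ℕ (a ℕ.* b) * ((ℚ[ a ] * 1/ℕ a) * (ℚ[ b ] * 1/ℕ b))
      ≡⟨ solve 5 (λ w x y z q → w :* ((x :* y) :* (z :* q)) := (x :* z :* w) :* (y :* q))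
               refl (1/ℕ (a ℕ.* b)) ℚ[ a ] (1/ℕ a) ℚ[ b ] (1/ℕ b) ⟩
    (ℚ[ a ] * ℚ[ b ] * 1/ℕ (a ℕ.* b)) * (1/ℕ a * 1/ℕ b)
      ≡⟨ cong (λ z → (z * 1/ℕ (a ℕ.* b)) * (1/ℕ a * 1/ℕ b)) (ℚ[]-homo-* a b) ⟨
    (ℚ[ a ℕ.* b ] * 1/ℕ (a ℕ.* b)) * (1/ℕ a * 1/ℕ b)         ≡⟨ cong (_* (1/ℕ a * 1/ℕ b)) (ℚ[]*1/ℕ (a ℕ.* b)) ⟩
    1ℚ * (1/ℕ a * 1/ℕ b)                                     ≡⟨ *-identityˡ _ ⟩
    1/ℕ a * 1/ℕ b                                            ∎
    where
    open ≡-Reasoning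
    ones : (ℚ[ a ] * 1/ℕ a) * (ℚ[ b ] * 1/ℕ b) ≡ 1ℚ
    ones = trans (cong₂ _*_ (ℚ[]*1/ℕ a) (ℚ[]*1/ℕ b)) (*-identityˡ 1ℚ)

  ≤-/ℕ : ∀ m .{{_ : ℕ.NonZero m}} A B E C D → m ℕ.* A ℕ.+ B ℕ.≤ m ℕ.* E ℕ.+ C ℕ.+ D →
         ℚ[ A ] + (ℚ[ B ] - ℚ[ C ] - ℚ[ D ]) /ℕ m ≤ ℚ[ E ]
  ≤-/ℕ m A B E C D ≤ℕ = subst₂ _≤_ lhs≡ rhs≡ (+-monoˡ-≤ (- ((c + d) * w)) (*-monoʳ-≤-nonNeg w {{1/ℕ-nonNeg m}} ≤ℚ))
    where
    open ≡-Reasoning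
    M w a b e c d : ℚ
    M = ℚ[ m ]
    w = 1/ℕ m
    a = ℚ[ A ]
    b = ℚ[ B ]
    e = ℚ[ E ]
    c = ℚ[ C ]
    d = ℚ[ D ]
    ≤ℚ : M * a + b ≤ M * e + c + d
    ≤ℚ = subst₂ _≤_ (trans (ℚ[]-homo-+ (m ℕ.* A) B) (cong (_+ b) (ℚ[]-homo-* m A)))
                    (trans (ℚ[]-homo-+ (m ℕ.* E ℕ.+ C) D)
                           (cong (_+ d) (trans (ℚ[]-homo-+ (m ℕ.* E) C) (cong (_+ c) (ℚ[]-homo-* m E)))))
                    (ℚ[]-mono-≤ ≤ℕ)
    lhs≡ : (M * a + b) * w + - ((c + d) * w) ≡ a + (b - c - d) /ℕ m
    lhs≡ = begin
      (M * a + b) * w + - ((c + d) * w)   ≡⟨ solve 6 (λ M a b c d w → (M :* a :+ b) :* w :+ (:- ((c :+ d) :* w))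
                                                                    := a :* (M :* w) :+ (b :- c :- d) :* w) refl M a b c d w ⟩
      a * (M * w) + (b - c - d) * w
        ≡⟨ cong₂ _+_ (trans (cong (a *_) (ℚ[]*1/ℕ m)) (*-identityʳ a)) (sym (/ℕ-≡-*1/ℕ _ m)) ⟩
      a + (b - c - d) /ℕ m                ∎
    rhs≡ : (M * e + c + d) * w + - ((c + d) * w) ≡ e
    rhs≡ = begin
      (M * e + c + d) * w + - ((c + d) * w)   ≡⟨ solve 5 (λ M e c d w → (M :* e :+ c :+ d) :* w :+ (:- ((c :+ d) :* w))
                                                                    := e :* (M :* w)) refl M e c d w ⟩
      e * (M * w)                             ≡⟨ trans (cong (e *_) (ℚ[]*1/ℕ m)) (*-identityʳ e) ⟩
      e                                       ∎

  Σ₁-cong : ∀ M {F G : ℕ → ℚ} → (∀ i → i ℕ.≤ M → F i ≡ G i) → Σ₁ M F ≡ Σ₁ M G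
  Σ₁-cong zero    F≗G = refl
  Σ₁-cong (suc M) F≗G = cong₂ _+_ (Σ₁-cong M (λ i i≤M → F≗G i (ℕ.m≤n⇒m≤1+n i≤M))) (F≗G (suc M) ℕ.≤-refl)

  Σ₁-*ˡ : ∀ M c (F : ℕ → ℚ) → Σ₁ M (λ i → c * F i) ≡ c * Σ₁ M F
  Σ₁-*ˡ zero    c F = sym (*-zeroʳ c)
  Σ₁-*ˡ (suc M) c F = trans (cong (_+ c * F (suc M)) (Σ₁-*ˡ M c F)) (sym (*-distribˡ-+ c (Σ₁ M F) (F (suc M))))

  /ℕ-*ˡ : ∀ c x a → (c * x) /ℕ a ≡ c * (x /ℕ a)
  /ℕ-*ˡ c x a = trans (/ℕ-≡-*1/ℕ (c * x) a) (trans (*-assoc c x (1/ℕ a)) (cong (c *_) (sym (/ℕ-≡-*1/ℕ x a))))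

  module Iteration (r″ t′ n′ e : ℕ) where
    r t n : ℕ
    r = 2 ℕ.+ r″
    t = suc t′
    n = suc n′

    open Combinatorics.BlowUp t

    T tq ρ h v u : ℚ
    T  = ℚ[ t ^ r ]
    tq = ℚ[ t ∸ 1 ]
    ρ  = ℚ[ r ∸ 1 ]
    h  = 1/ℕ 2
    v  = 1/ℕ t
    u  = 1/ℕ n

    ℚ[t^r+] : ∀ x → ℚ[ t ^ (r ℕ.+ x) ] ≡ T * ℚ[ t ^ x ]
    ℚ[t^r+] x = trans (cong ℚ[_] (ℕ.^-distribˡ-+-* t r x)) (ℚ[]-homo-* (t ^ r) (t ^ x))

    ℚ[t^r+*] : ∀ x y → ℚ[ t ^ (r ℕ.+ x) ℕ.* y ] ≡ T * ℚ[ t ^ x ℕ.* y ]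
    ℚ[t^r+*] x y = begin
      ℚ[ t ^ (r ℕ.+ x) ℕ.* y ]       ≡⟨ ℚ[]-homo-* (t ^ (r ℕ.+ x)) y ⟩
      ℚ[ t ^ (r ℕ.+ x) ] * ℚ[ y ]    ≡⟨ cong (_* ℚ[ y ]) (ℚ[t^r+] x) ⟩
      T * ℚ[ t ^ x ] * ℚ[ y ]        ≡⟨ *-assoc T _ _ ⟩
      T * (ℚ[ t ^ x ] * ℚ[ y ])      ≡⟨ cong (T *_) (ℚ[]-homo-* (t ^ x) y) ⟨
      T * ℚ[ t ^ x ℕ.* y ]           ∎
      where open ≡-Reasoning

    ℚ[t]*v : ℚ[ t ] * v ≡ 1ℚ
    ℚ[t]*v = ℚ[]*1/ℕ t

    ℚ[t]≡1+tq : ℚ[ t ] ≡ 1ℚ + tq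
    ℚ[t]≡1+tq = ℚ[]-homo-+ 1 t′

    ℚ[oneCollisionCount] : ∀ m → ℚ[ oneCollisionCount m r ] ≡ ρ * (tq * h) * T * ℚ[ m C (r ∸ 1) ] * v
    ℚ[oneCollisionCount] m = begin
      ℚ[ (t C 2) ℕ.* t ^ r″ ℕ.* (ℕ.suc r″ ℕ.* d) ]
        ≡⟨ trans (ℚ[]-homo-* ((t C 2) ℕ.* t ^ r″) _) (cong₂ _*_ (ℚ[]-homo-* (t C 2) (t ^ r″)) (ℚ[]-homo-* (suc r″) d)) ⟩
      ℚ[ t C 2 ] * P * (ρ * D)
        ≡⟨ cong (λ z → z * P * (ρ * D)) ℚ[tC2] ⟩
      ℚ[ t ] * tq * h * P * (ρ * D)
        ≡⟨ solve 7 (λ τ q h P ρ D v → τ :* q :* h :* P :* (ρ :* D) := ρ :* q :* h :* τ :* P :* D :* con 1ℚ)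
                 refl ℚ[ t ] tq h P ρ D v ⟩
      ρ * tq * h * ℚ[ t ] * P * D * 1ℚ
        ≡⟨ cong (ρ * tq * h * ℚ[ t ] * P * D *_) ℚ[t]*v ⟨
      ρ * tq * h * ℚ[ t ] * P * D * (ℚ[ t ] * v)
        ≡⟨ solve 7 (λ τ q h P ρ D v → ρ :* q :* h :* τ :* P :* D :* (τ :* v) := ρ :* (q :* h) :* (τ :* (τ :* P)) :* D :* v)
                 refl ℚ[ t ] tq h P ρ D v ⟩
      ρ * (tq * h) * (ℚ[ t ] * (ℚ[ t ] * P)) * D * v
        ≡⟨ cong (λ z → ρ * (tq * h) * z * D * v)
                (trans (ℚ[]-homo-* t (t ℕ.* t ^ r″)) (cong (ℚ[ t ] *_) (ℚ[]-homo-* t (t ^ r″)))) ⟨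
      ρ * (tq * h) * T * D * v
        ∎
      where
      open ≡-Reasoning
      d : ℕ
      d = m C suc r″
      D P : ℚ
      D = ℚ[ d ]
      P = ℚ[ t ^ r″ ]
      ℚ[tC2] : ℚ[ t C 2 ] ≡ ℚ[ t ] * tq * h
      ℚ[tC2] = begin
        ℚ[ t C 2 ]                     ≡⟨ *-identityʳ _ ⟨
        ℚ[ t C 2 ] * 1ℚ                ≡⟨ cong (ℚ[ t C 2 ] *_) (ℚ[]*1/ℕ 2) ⟨
        ℚ[ t C 2 ] * (ℚ[ 2 ] * h)      ≡⟨ solve 3 (λ c two h → c :* (two :* h) := (two :* c) :* h) refl ℚ[ t C 2 ] ℚ[ 2 ] h ⟩
        (ℚ[ 2 ] * ℚ[ t C 2 ]) * h
          ≡⟨ cong (_* h) (trans (sym (ℚ[]-homo-* 2 (t C 2))) (trans (cong ℚ[_] (2*[1+n]C2 t′)) (ℚ[]-homo-* t t′))) ⟩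
        ℚ[ t ] * tq * h                ∎

    blowUpGain : ℕ → ℚ
    blowUpGain m = (ℚ[ (m ℕ.* t) C r ] - ℚ[ t ^ r ℕ.* (m C r) ] - ℚ[ oneCollisionCount m r ]) /ℕ m

    blowUpGain≡ : ∀ m → blowUpGain m ≡
                  (ℚ[ (m ℕ.* t) C r ] - T * ℚ[ m C r ] - ρ * (tq * h) * T * ℚ[ m C (r ∸ 1) ] * v) * 1/ℕ m
    blowUpGain≡ m = trans (/ℕ-≡-*1/ℕ _ m)
      (cong (_* 1/ℕ m) (cong₂ (λ x y → ℚ[ (m ℕ.* t) C r ] - x - y)
                              (ℚ[]-homo-* (t ^ r) (m C r)) (ℚ[oneCollisionCount] m)))

    ExLowerBound : ℕ → ℚ → Set
    ExLowerBound m q = Σ (Hypergraph r m) λ G → HFree (suc t) G × q ≤ ℚ[ ∥ G ∥ ]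

    ExLowerBound-blowUp : ∀ m .{{_ : NonZero m}} {q} → suc t ℕ.≤ suc r →
                          ExLowerBound m q → ExLowerBound (m ℕ.* t) (T * q + blowUpGain m)
    ExLowerBound-blowUp m k≤r+1 (G , G-free , q≤) with G′ , G′-free , ≤ℕ ← blowUp-step k≤r+1 G G-free =
      G′ , G′-free , ≤-trans (+-monoˡ-≤ (blowUpGain m) (*-monoˡ-≤-nonNeg T {{ℚ[]-nonNeg (t ^ r)}} q≤))
                             (subst (_≤ ℚ[ ∥ G′ ∥ ]) (cong (_+ blowUpGain m) (ℚ[]-homo-* (t ^ r) ∥ G ∥))
                                    (≤-/ℕ m _ _ _ _ _ ≤ℕ))

    exTerm rSetSum topTerm baseTerm collisionSum : ℕ → ℚ
    exTerm s       = ℚ[ t ^ (s ℕ.* r) ℕ.* e ]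
    rSetSum s      = Σ₁ (s ∸ 1) (λ i → (ℚ[ t ∸ 1 ] * ℚ[ t ^ ((s ∸ i) ℕ.* r) ] * ℚ[ (t ^ i ℕ.* n) C r ]) /ℕ (t ^ i))
    topTerm s      = ℚ[ (t ^ s ℕ.* n) C r ] /ℕ (t ^ (s ∸ 1))
    baseTerm s     = ℚ[ t ^ (s ℕ.* r) ℕ.* (n C r) ]
    collisionSum s = Σ₁ s (λ i → ((ℚ[ t ∸ 1 ] /ℕ 2) * ℚ[ t ^ ((s ∸ i) ℕ.* r ℕ.+ r) ]
                                   * ℚ[ (t ^ (i ∸ 1) ℕ.* n) C (r ∸ 1) ]) /ℕ (t ^ i))

    assemble : ℚ → ℚ → ℚ → ℚ → ℚ → ℚ
    assemble a b c d f = a + b /ℕ n + c /ℕ n - d /ℕ n - (ρ * f) /ℕ n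

    assemble-cong : ∀ {a a′ b b′ c c′ d d′ f f′} → a ≡ a′ → b ≡ b′ → c ≡ c′ → d ≡ d′ → f ≡ f′ →
                    assemble a b c d f ≡ assemble a′ b′ c′ d′ f′
    assemble-cong refl refl refl refl refl = refl

    -- Definitionally the right-hand side of the theorem.
    bound : ℕ → ℚ
    bound s = assemble (exTerm s) (rSetSum s) (topTerm s) (baseTerm s) (collisionSum s)

    ℚ[t^1r*] : ∀ y → ℚ[ t ^ (1 ℕ.* r) ℕ.* y ] ≡ T * ℚ[ y ]
    ℚ[t^1r*] y = trans (cong (λ x → ℚ[ t ^ x ℕ.* y ]) (ℕ.+-identityʳ r)) (ℚ[]-homo-* (t ^ r) y)

    bound-one : bound 1 ≡ T * ℚ[ e ] + blowUpGain n
    bound-one = begin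
      bound 1
        ≡⟨ assemble-cong (ℚ[t^1r*] e) (refl {x = 0ℚ}) topTerm-one (ℚ[t^1r*] (n C r)) collisionSum-one ⟩
      assemble (T * E) 0ℚ (c′ * 1ℚ) (T * c) (0ℚ + (tq * h) * T * d * v)
        ≡⟨ solve 10 (λ T E c′ c d tq h v ρ u →
                       T :* E :+ con 0ℚ :* u :+ (c′ :* con 1ℚ) :* u :- (T :* c) :* u
                         :- (ρ :* (con 0ℚ :+ (tq :* h) :* T :* d :* v)) :* u
                     := T :* E :+ (c′ :- T :* c :- ρ :* (tq :* h) :* T :* d :* v) :* u)
                 refl T E c′ c d tq h v ρ u ⟩
      T * E + (c′ - T * c - ρ * (tq * h) * T * d * v) * u
        ≡⟨ cong (λ z → T * E + z) (blowUpGain≡ n) ⟨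
      T * E + blowUpGain n
        ∎
      where
      open ≡-Reasoning
      E c c′ d : ℚ
      E  = ℚ[ e ]
      c  = ℚ[ n C r ]
      c′ = ℚ[ (n ℕ.* t) C r ]
      d  = ℚ[ n C (r ∸ 1) ]
      topTerm-one : topTerm 1 ≡ c′ * 1ℚ
      topTerm-one = cong (λ x → ℚ[ x C r ] * 1ℚ) (trans (cong (ℕ._* n) (ℕ.*-identityʳ t)) (ℕ.*-comm t n))
      collisionSum-one : collisionSum 1 ≡ 0ℚ + (tq * h) * T * d * v
      collisionSum-one = cong₂ (λ x y → 0ℚ + ((tq * h) * T * ℚ[ x C (r ∸ 1) ]) * 1/ℕ y) (ℕ.*-identityˡ n) (ℕ.*-identityʳ t)

    factor-T : ∀ q j C a → (q * ℚ[ t ^ (r ℕ.+ j) ] * C) /ℕ a ≡ T * ((q * ℚ[ t ^ j ] * C) /ℕ a)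
    factor-T q j C a = begin
      (q * ℚ[ t ^ (r ℕ.+ j) ] * C) /ℕ a    ≡⟨ cong (λ z → (q * z * C) /ℕ a) (ℚ[t^r+] j) ⟩
      (q * (T * ℚ[ t ^ j ]) * C) /ℕ a      ≡⟨ cong (_/ℕ a) (solve 4 (λ q T y C → q :* (T :* y) :* C := T :* (q :* y :* C))
                                                               refl q T ℚ[ t ^ j ] C) ⟩
      (T * (q * ℚ[ t ^ j ] * C)) /ℕ a      ≡⟨ /ℕ-*ˡ T _ a ⟩
      T * ((q * ℚ[ t ^ j ] * C) /ℕ a)      ∎
      where open ≡-Reasoning

    module _ (σ : ℕ) where
      private
        instance
          t^σ≢0 : NonZero (t ^ σ)
          t^σ≢0 = ℕ.m^n≢0 t σ
          t^1+σ≢0 : NonZero (t ^ suc σ)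
          t^1+σ≢0 = ℕ.m^n≢0 t (suc σ)

      m : ℕ
      m  = t ^ suc σ ℕ.* n

      w c c′ d : ℚ
      w  = 1/ℕ (t ^ suc σ)
      c  = ℚ[ m C r ]
      c′ = ℚ[ (m ℕ.* t) C r ]
      d  = ℚ[ m C (r ∸ 1) ]

      rSetSum-suc : rSetSum (2 ℕ.+ σ) ≡ T * rSetSum (suc σ) + tq * T * c * w
      rSetSum-suc = cong₂ _+_ (trans (Σ₁-cong σ scale) (Σ₁-*ˡ σ T _)) last
        where
        scale : ∀ i → i ℕ.≤ σ →
                (tq * ℚ[ t ^ ((2 ℕ.+ σ ∸ i) ℕ.* r) ] * ℚ[ (t ^ i ℕ.* n) C r ]) /ℕ (t ^ i)
                ≡ T * ((tq * ℚ[ t ^ ((suc σ ∸ i) ℕ.* r) ] * ℚ[ (t ^ i ℕ.* n) C r ]) /ℕ (t ^ i))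
        scale i i≤σ = trans (cong (λ z → (tq * ℚ[ t ^ (z ℕ.* r) ] * ℚ[ (t ^ i ℕ.* n) C r ]) /ℕ (t ^ i))
                                  (ℕ.+-∸-assoc 1 (ℕ.m≤n⇒m≤1+n i≤σ)))
                            (factor-T tq ((suc σ ∸ i) ℕ.* r) _ (t ^ i))
        last : (tq * ℚ[ t ^ ((2 ℕ.+ σ ∸ suc σ) ℕ.* r) ] * c) /ℕ (t ^ suc σ) ≡ tq * T * c * w
        last = trans (cong (λ z → (tq * ℚ[ t ^ (z ℕ.* r) ] * c) /ℕ (t ^ suc σ)) (ℕ.m+n∸n≡m 1 (suc σ)))
                     (trans (cong (λ z → (tq * ℚ[ t ^ z ] * c) /ℕ (t ^ suc σ)) (ℕ.+-identityʳ r))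
                            (/ℕ-≡-*1/ℕ _ (t ^ suc σ)))

      collisionSum-suc : collisionSum (2 ℕ.+ σ) ≡ T * collisionSum (suc σ) + (tq * h) * T * d * (v * w)
      collisionSum-suc = cong₂ _+_ (trans (Σ₁-cong (suc σ) scale) (Σ₁-*ˡ (suc σ) T _)) last
        where
        C′ : ℕ → ℚ
        C′ i = ℚ[ (t ^ (i ∸ 1) ℕ.* n) C (r ∸ 1) ]
        scale : ∀ i → i ℕ.≤ suc σ →
                ((tq * h) * ℚ[ t ^ ((2 ℕ.+ σ ∸ i) ℕ.* r ℕ.+ r) ] * C′ i) /ℕ (t ^ i)
                ≡ T * (((tq * h) * ℚ[ t ^ ((suc σ ∸ i) ℕ.* r ℕ.+ r) ] * C′ i) /ℕ (t ^ i))
        scale i i≤1+σ = trans (cong (λ z → ((tq * h) * ℚ[ t ^ z ] * C′ i) /ℕ (t ^ i))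
                                    (trans (cong (λ z → z ℕ.* r ℕ.+ r) (ℕ.+-∸-assoc 1 i≤1+σ))
                                           (ℕ.+-assoc r ((suc σ ∸ i) ℕ.* r) r)))
                              (factor-T (tq * h) ((suc σ ∸ i) ℕ.* r ℕ.+ r) (C′ i) (t ^ i))
        last : ((tq * h) * ℚ[ t ^ ((2 ℕ.+ σ ∸ (2 ℕ.+ σ)) ℕ.* r ℕ.+ r) ] * d) /ℕ (t ^ (2 ℕ.+ σ)) ≡ (tq * h) * T * d * (v * w)
        last = begin
          ((tq * h) * ℚ[ t ^ ((2 ℕ.+ σ ∸ (2 ℕ.+ σ)) ℕ.* r ℕ.+ r) ] * d) /ℕ (t ^ (2 ℕ.+ σ))
            ≡⟨ cong (λ z → ((tq * h) * ℚ[ t ^ (z ℕ.* r ℕ.+ r) ] * d) /ℕ (t ^ (2 ℕ.+ σ))) (ℕ.n∸n≡0 (2 ℕ.+ σ)) ⟩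
          ((tq * h) * T * d) /ℕ (t ^ (2 ℕ.+ σ))
            ≡⟨ /ℕ-≡-*1/ℕ _ (t ^ (2 ℕ.+ σ)) ⟩
          (tq * h) * T * d * 1/ℕ (t ℕ.* t ^ suc σ)
            ≡⟨ cong ((tq * h) * T * d *_) (1/ℕ-* t (t ^ suc σ)) ⟩
          (tq * h) * T * d * (v * w)
            ∎
          where open ≡-Reasoning

      topTerm-suc : topTerm (2 ℕ.+ σ) ≡ c′ * w
      topTerm-suc = trans (cong (λ z → ℚ[ z C r ] /ℕ (t ^ suc σ)) (trans (ℕ.*-assoc t (t ^ suc σ) n) (ℕ.*-comm t m)))
                          (/ℕ-≡-*1/ℕ c′ (t ^ suc σ))

      topTerm-eq : topTerm (suc σ) ≡ c * ((1ℚ + tq) * w)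
      topTerm-eq = trans (/ℕ-≡-*1/ℕ c (t ^ σ)) (cong (c *_) (begin
        1/ℕ (t ^ σ)                       ≡⟨ *-identityˡ _ ⟨
        1ℚ * 1/ℕ (t ^ σ)                  ≡⟨ cong (_* 1/ℕ (t ^ σ)) ℚ[t]*v ⟨
        ℚ[ t ] * v * 1/ℕ (t ^ σ)          ≡⟨ *-assoc ℚ[ t ] v _ ⟩
        ℚ[ t ] * (v * 1/ℕ (t ^ σ))        ≡⟨ cong₂ _*_ ℚ[t]≡1+tq (sym (1/ℕ-* t (t ^ σ))) ⟩
        (1ℚ + tq) * w                     ∎))
        where open ≡-Reasoning

      bound-suc : bound (2 ℕ.+ σ) ≡ T * bound (suc σ) + blowUpGain m
      bound-suc = begin
        bound (2 ℕ.+ σ)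
          ≡⟨ assemble-cong (ℚ[t^r+*] (suc σ ℕ.* r) e) rSetSum-suc topTerm-suc
                           (ℚ[t^r+*] (suc σ ℕ.* r) (n C r)) collisionSum-suc ⟩
        assemble (T * x) (T * S₁ + tq * T * c * w) (c′ * w) (T * C₀) (T * S₂ + (tq * h) * T * d * (v * w))
          ≡⟨ solve 14 (λ T x S₁ S₂ C₀ c c′ d tq h ρ v w u →
                 T :* x :+ (T :* S₁ :+ tq :* T :* c :* w) :* u :+ (c′ :* w) :* u :- (T :* C₀) :* u
                   :- (ρ :* (T :* S₂ :+ (tq :* h) :* T :* d :* (v :* w))) :* u
               := T :* (x :+ S₁ :* u :+ (c :* ((con 1ℚ :+ tq) :* w)) :* u :- C₀ :* u :- (ρ :* S₂) :* u)
                   :+ (c′ :- T :* c :- ρ :* (tq :* h) :* T :* d :* v) :* (w :* u))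
               refl T x S₁ S₂ C₀ c c′ d tq h ρ v w u ⟩
        T * assemble x S₁ (c * ((1ℚ + tq) * w)) C₀ S₂ + (c′ - T * c - ρ * (tq * h) * T * d * v) * (w * u)
          ≡⟨ cong₂ (λ p q → T * assemble x S₁ p C₀ S₂ + q) (sym topTerm-eq)
                   (trans (cong ((c′ - T * c - ρ * (tq * h) * T * d * v) *_) (sym (1/ℕ-* (t ^ suc σ) n)))
                          (sym (blowUpGain≡ m))) ⟩
        T * bound (suc σ) + blowUpGain m
          ∎
        where
        open ≡-Reasoning
        x S₁ S₂ C₀ : ℚ
        x = exTerm (suc σ)
        S₁ = rSetSum (suc σ)
        S₂ = collisionSum (suc σ)
        C₀ = baseTerm (suc σ)

    module _ (k≤r+1 : suc t ℕ.≤ suc r) where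

      ex-lower-bound : ExLowerBound n ℚ[ e ] → ∀ σ → ExLowerBound (t ^ suc σ ℕ.* n) (bound (suc σ))
      ex-lower-bound base zero =
        subst₂ ExLowerBound (trans (ℕ.*-comm n t) (cong (ℕ._* n) (sym (ℕ.*-identityʳ t))))
                            (sym bound-one)
                            (ExLowerBound-blowUp n k≤r+1 base)
      ex-lower-bound base (suc σ) =
        subst₂ ExLowerBound (trans (ℕ.*-comm (m σ) t) (sym (ℕ.*-assoc t (t ^ suc σ) n)))
                            (sym (bound-suc σ))
                            (ExLowerBound-blowUp (m σ) {{ℕ.m*n≢0 (t ^ suc σ) n {{ℕ.m^n≢0 t (suc σ)}}}} k≤r+1
                                                 (ex-lower-bound base σ))

open Rationals using (ℚ[]-mono-≤; module Iteration)
open import Data.Nat as ℕ using (_≤_; _∸_; _^_; s≤s)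
open import Data.Nat.Combinatorics using (_C_)
open import Data.Rational using (_+_; _-_; _*_) renaming (_≥_ to _≥ℚ_)
open import Data.Rational.Properties using (≤-trans; ≤-reflexive)
open import Data.Product using (_,_)
open import Relation.Binary.PropositionalEquality using (sym; cong)

corollary12 : (r k n s : ℕ) → 2 ≤ r → 2 ≤ k → k ≤ ℕ.suc r → 1 ≤ n → 1 ≤ s →
    let t = k ∸ 1 in
    (e e′ : ℕ) → IsEx r k n e → IsEx r k (t ^ s ℕ.* n) e′ →
    ℚ[ e′ ] ≥ℚ
      (ℚ[ t ^ (s ℕ.* r) ℕ.* e ]
       + Σ₁ (s ∸ 1) (λ i → (ℚ[ t ∸ 1 ] * ℚ[ t ^ ((s ∸ i) ℕ.* r) ] * ℚ[ (t ^ i ℕ.* n) C r ]) /ℕ (t ^ i)) /ℕ n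
       + (ℚ[ (t ^ s ℕ.* n) C r ] /ℕ (t ^ (s ∸ 1))) /ℕ n
       - ℚ[ t ^ (s ℕ.* r) ℕ.* (n C r) ] /ℕ n
       - (ℚ[ r ∸ 1 ] * Σ₁ s (λ i → ((ℚ[ t ∸ 1 ] /ℕ 2) * ℚ[ t ^ ((s ∸ i) ℕ.* r ℕ.+ r) ] * ℚ[ (t ^ (i ∸ 1) ℕ.* n) C (r ∸ 1) ]) /ℕ (t ^ i))) /ℕ n)
corollary12 _ _ _ _ (s≤s (s≤s {n = r″} _)) (s≤s (s≤s {n = t′} _)) k≤r+1 (s≤s {n = n′} _) (s≤s {n = σ} _)
            e e′ ((G , G-free , ∥G∥≡e) , _) (_ , maximal) =
  let G′ , G′-free , bound≤∥G′∥ = ex-lower-bound k≤r+1 (G , G-free , ≤-reflexive (cong ℚ[_] (sym ∥G∥≡e))) σ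
  in ≤-trans bound≤∥G′∥ (ℚ[]-mono-≤ (maximal G′ G′-free))
  where open Iteration r″ t′ n′ e
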